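{- Let $\mathfrak{G}$ be a group and $\Phi$ a $\mathfrak{G}$-gain graph with edge set $E$, neutral edge set $E_0$ and neutral subgraph $\Gamma_0=(V,E_0)$. In the neutral chromatic group $\mathrm{CT}_N(\mathfrak{G})$, \[ \Phi=\sum_{S\in\mathcal{F}(\Gamma_0)}\mu_0(\emptyset,S)\,\big[(\Phi/S)\setminus (E_0\setminus S)\big]=\sum_{S\subseteq E_0}(-1)^{|S|}\,\big[(\Phi/S)\setminus (E_0\setminus S)\big]. \]
   Context: A $\mathfrak{G}$-gain graph is a finite graph (loops and multiple edges allowed, vertices and edges labelled) with a gain map assigning to each oriented edge an element of $\mathfrak{G}$ such that reversing orientation inverts the gain; an edge is neutral if its gain is $1_{\mathfrak{G}}$. For a set $S$ of neutral edges, $\Phi/S$ has vertex set the partition $\pi(S)$ of $V$ into vertex sets of connected components of $(V,S)$, edge set $E\setminus S$, each remaining edge having as endpoints the blocks containing its original endpoints, with unchanged gain. $\Phi\setminus T$ deletes the edges in $T$. The neutral chromatic group $\mathrm{CT}_N(\mathfrak{G})$ is the free abelian group generated by all $\mathfrak{G}$-gain graphs modulo the relations $\Phi=(\Phi\setminus e)-(\Phi/e)$ for every neutral link $e$ of $\Phi$, and $\Phi=0$ whenever $\Phi$ has a neutral loop. An edge set $S$ of $\Gamma_0$ is closed if every edge of $\Gamma_0$ whose endpoints are joined by a path in $S$ belongs to $S$; $\mathcal{F}(\Gamma_0)$ is the lattice of closed sets and $\mu_0$ its Möbius function; if $\emptyset$ is not closed (i.e. $\Gamma_0$ has loops), $\mu_0(\emptyset,S)$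 is defined to be $0$ for all $S$. -}

module Defs where

open import Level using (_⊔_)
open import Algebra.Bundles using (Group)
open import Data.Bool using (Bool; true; false; not; _∨_; if_then_else_)
open import Data.Bool.ListAction using (any; all)
open import Data.Nat using (ℕ; zero; suc; _≡ᵇ_)
open import Data.Integer using (ℤ; +_; -[1+_]; -_; _+_)
open import Data.List using (List; []; _∷_; map; concat; filterᵇ; partitionᵇ; foldl; foldr; _++_; length; lookup)
open import Data.List.Membership.Propositional using (_∈_)
open import Data.List.Relation.Unary.Unique.Propositional using (Unique)
open import Data.List.Relation.Unary.All using (All)
open import Data.List.Relation.Binary.Sublist.Propositional using (_⊆_)
open import Data.Fin using (Fin)
open import Data.Product using (_×_; _,_; Σ; ∃)
open import Data.Sum using (_⊎_)
open import Relation.Nullary using (¬_)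
open import Relation.Binary.PropositionalEquality using (_≡_)

-- Conventions:
--  * vertex labels: a vertex is a (nonempty) finite set of "atoms" (natural
--    numbers), given as a list; two vertices are the same iff they have the
--    same atoms.  Contracting merges blocks by taking the union of atoms, so
--    the block {u,v} of pi(S) is labelled by the union of the labels of u,v.
--  * edge labels: natural numbers, distinct within a graph.

Vtx : Set
Vtx = List ℕ

_≐_ : Vtx → Vtx → Set
u ≐ v = ∀ a → (a ∈ u → a ∈ v) × (a ∈ v → a ∈ u)

_∈ᵇ_ : ℕ → List ℕ → Bool
a ∈ᵇ xs = any (a ≡ᵇ_) xs

meets : List ℕ → List ℕ → Bool
meets b u = any (λ a → a ∈ᵇ b) u

splits : ∀ {a} {A : Set a} → List A → List (List A × List A)
splits [] = ([] , []) ∷ []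
splits (x ∷ xs) =
  map (λ { (s , c) → (x ∷ s , c) }) (splits xs) ++
  map (λ { (s , c) → (s , x ∷ c) }) (splits xs)

sumℤ : List ℤ → ℤ
sumℤ = foldr _+_ (+ 0)

module GainGraphs {c ℓ} (G : Group c ℓ) where
  open Group G

  -- an edge, stored with one orientation: the oriented edge src→tgt has gain
  -- `gain`, the reverse orientation has gain `gain ⁻¹`
  record Edge : Set c where
    constructor edge
    field
      lbl  : ℕ
      src  : Vtx
      tgt  : Vtx
      gain : Carrier
  open Edge public

  record GG : Set c where
    constructor gg
    field
      V : List Vtx
      E : List Edge
  open GG public

  Neutral : Edge → Set ℓ
  Neutral e = gain e ≈ ε

  record WF (Φ : GG) : Set c where
    field
      nonempty : All (λ u → ¬ (u ≡ [])) (V Φ)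
      disjoint : ∀ (i j : Fin (length (V Φ))) (a : ℕ) →
                 a ∈ lookup (V Φ) i → a ∈ lookup (V Φ) j → i ≡ j
      srcV     : All (λ e → src e ∈ V Φ) (E Φ)
      tgtV     : All (λ e → tgt e ∈ V Φ) (E Φ)
      uniqueL  : Unique (map lbl (E Φ))

  IsLoop : Edge → Set
  IsLoop e = src e ≐ tgt e

  NeutralPart : GG → List Edge → Set (c ⊔ ℓ)
  NeutralPart Φ E₀ = (E₀ ⊆ E Φ) × All Neutral E₀ ×
                     (∀ e → e ∈ E Φ → Neutral e → e ∈ E₀)

  delete : List ℕ → GG → GG
  delete ls Φ = gg (V Φ) (filterᵇ (λ e → not (lbl e ∈ᵇ ls)) (E Φ))

  labels : List Edge → List ℕ
  labels = map lbl

  blockOf : List (List ℕ) → Vtx → List ℕ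
  blockOf P u = concat (filterᵇ (λ b → meets b u) P)

  mergeP : Vtx → Vtx → List (List ℕ) → List (List ℕ)
  mergeP u v P with partitionᵇ (λ b → meets b u ∨ meets b v) P
  ... | hit , miss = concat hit ∷ miss

  -- π(S): partition of V into vertex sets of components of (V,S);
  -- each block is represented by the union of the atoms of its vertices
  blocks : List Vtx → List Edge → List (List ℕ)
  blocks Vs S = foldl (λ P e → mergeP (src e) (tgt e) P) Vs S

  contract : GG → List Edge → GG
  contract Φ S =
    let P = blocks (V Φ) S in
    gg P (map (λ e → edge (lbl e) (blockOf P (src e)) (blockOf P (tgt e)) (gain e))
              (filterᵇ (λ e → not (lbl e ∈ᵇ labels S)) (E Φ)))

  -- same labelled gain graph (up to the order of lists / orientation of edges)
  EdgeEq : Edge → Edge → Set ℓ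
  EdgeEq e f = lbl e ≡ lbl f ×
    ((src e ≐ src f × tgt e ≐ tgt f × gain e ≈ gain f) ⊎
     (src e ≐ tgt f × tgt e ≐ src f × gain e ≈ gain f ⁻¹))

  _≅_ : GG → GG → Set (c ⊔ ℓ)
  Φ ≅ Ψ = (∀ u → u ∈ V Φ → Σ Vtx λ v → v ∈ V Ψ × u ≐ v) ×
          (∀ v → v ∈ V Ψ → Σ Vtx λ u → u ∈ V Φ × u ≐ v) ×
          (∀ e → e ∈ E Φ → Σ Edge λ f → f ∈ E Ψ × EdgeEq e f) ×
          (∀ f → f ∈ E Ψ → Σ Edge λ e → e ∈ E Φ × EdgeEq e f)

  -- The neutral chromatic group CT_N(G): formal Z-combinations of gain
  -- graphs (free abelian group) modulo the deletion-contraction and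
  -- neutral-loop relations.
  infixl 6 _⊕_
  data Expr : Set c where
    [_] : GG → Expr
    0#  : Expr
    _⊕_ : Expr → Expr → Expr
    ⊝_  : Expr → Expr

  infix 4 _∼_
  data _∼_ : Expr → Expr → Set (c ⊔ ℓ) where
    ∼-refl  : ∀ {x} → x ∼ x
    ∼-sym   : ∀ {x y} → x ∼ y → y ∼ x
    ∼-trans : ∀ {x y z} → x ∼ y → y ∼ z → x ∼ z
    ⊕-cong  : ∀ {x y u v} → x ∼ y → u ∼ v → x ⊕ u ∼ y ⊕ v
    ⊝-cong  : ∀ {x y} → x ∼ y → ⊝ x ∼ ⊝ y
    ⊕-assoc : ∀ x y z → (x ⊕ y) ⊕ z ∼ x ⊕ (y ⊕ z)
    ⊕-comm  : ∀ x y → x ⊕ y ∼ y ⊕ x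
    ⊕-idˡ   : ∀ x → 0# ⊕ x ∼ x
    ⊝-invˡ  : ∀ x → (⊝ x) ⊕ x ∼ 0#
    -- generators are labelled gain graphs
    gen-≅   : ∀ {Φ Ψ} → WF Φ → WF Ψ → Φ ≅ Ψ → [ Φ ] ∼ [ Ψ ]
    del-con : ∀ Φ e → WF Φ → e ∈ E Φ → Neutral e → ¬ IsLoop e →
              [ Φ ] ∼ [ delete (lbl e ∷ []) Φ ] ⊕ (⊝ [ contract Φ (e ∷ []) ])
    nloop   : ∀ Φ e → WF Φ → e ∈ E Φ → Neutral e → IsLoop e → [ Φ ] ∼ 0#

  rep : ℕ → Expr → Expr
  rep zero x = 0#
  rep (suc n) x = x ⊕ rep n x

  infixr 7 _·_
  _·_ : ℤ → Expr → Expr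
  (+ n) · x = rep n x
  -[1+ n ] · x = ⊝ rep (suc n) x

  Σᴱ : List Expr → Expr
  Σᴱ = foldr _⊕_ 0#

  module _ (Φ : GG) (E₀ : List Edge) where

    -- endpoints of e joined by a path in S  (same block of π(S))
    joinedᵇ : List Edge → Edge → Bool
    joinedᵇ S e = meets (blockOf (blocks (V Φ) S) (src e)) (tgt e)

    closedᵇ : List Edge → Bool
    closedᵇ S = all (λ e → not (joinedᵇ S e) ∨ (lbl e ∈ᵇ labels S)) E₀

    properSubsets : List Edge → List (List Edge)
    properSubsets S = map (λ p → Data.Product.proj₁ p)
      (filterᵇ (λ { (_ , []) → false ; (_ , (_ ∷ _)) → true }) (splits S))

    -- μ(∅,S) in the lattice of closed sets, assuming ∅ is closed;
    -- first argument is fuel (≥ |S|)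
    mu : ℕ → List Edge → ℤ
    mu _ [] = + 1
    mu zero (_ ∷ _) = + 0
    mu (suc n) S@(_ ∷ _) =
      - sumℤ (map (λ T → if closedᵇ T then mu n T else + 0) (properSubsets S))

    μ₀ : List Edge → ℤ
    μ₀ S = if closedᵇ [] then mu (length S) S else + 0

    -- [(Φ/S) \ (E₀ \ S)], given S and C = E₀ \ S
    term : List Edge → List Edge → Expr
    term S C = [ delete (labels C) (contract Φ S) ]

    möbiusSum : Expr
    möbiusSum = Σᴱ (map (λ { (S , C) → if closedᵇ S then μ₀ S · term S C else 0# })
                        (splits E₀))

    signedSum : Expr
    signedSum = Σᴱ (map (λ { (S , C) → (Data.Integer._^_ (- (+ 1)) (length S)) · term S C })
                        (splits E₀))

-- Deleting and contracting the edges of E₀ one at a time, Φ = (Φ \ e) - (Φ / e) expands Φ as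
-- Σ_{S ⊆ E₀} (-1)^|S| [(Φ/S) \ (E₀ \ S)]; a neutral loop e fits the same step, as then Φ = 0 and
-- Φ \ e = Φ / e. The minor (Φ/S) \ (E₀ \ S) depends on S only through the partition π(S), so it is
-- the minor of the closure cl S, and grouping the subsets S by their closure T gives T the coefficient
-- c(T) = Σ_{cl S = T} (-1)^|S|. For closed T, every S ⊆ T has cl S ⊆ T, hence
-- Σ_{U ⊆ T closed} c(U) = Σ_{S ⊆ T} (-1)^|S| = [T = ∅], which is the recursion defining μ₀(∅, T).
-- Minors are compared through the equivalence relation their vertices induce on the atoms of the
-- vertex labels of Φ, together with the edges of Φ they keep.

module Submission where

open import Defs
open import Level using (Level; _⊔_)
open import Algebra.Bundles using (Group; CommutativeMonoid; AbelianGroup)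
open import Data.Bool using (Bool; true; false; T; not; _∧_; _∨_; if_then_else_)
open import Data.Bool.Properties using (T?; T-∧; T-∨; T-≡)
open import Data.Bool.ListAction using (any; all)
open import Data.Empty using (⊥; ⊥-elim)
open import Data.Fin using (Fin) renaming (zero to fzero; suc to fsuc)
import Data.Fin.Properties as Fin
open import Data.Integer using (ℤ; +_; -[1+_]; -_; _⊖_; _^_) renaming (_+_ to _+ℤ_)
import Data.Integer.Properties as ℤ
open import Data.Nat using (ℕ; zero; suc; _+_; _≤_; _<_; s≤s; s≤s⁻¹; z≤n; _≟_; _≡ᵇ_)
import Data.Nat.Properties as ℕ
open import Data.List using (List; []; _∷_; map; _++_; concat; length; filter; filterᵇ; foldl; foldr; lookup)
open import Data.List.Properties
  using (≡-dec; map-++; map-∘; ∷-injectiveʳ; ++-assoc; ++-identityʳ; foldl-++; partition-defn; filter-accept; filter-reject; filter-none; filter-all)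
open import Data.List.Membership.Propositional using (_∈_; find; lose)
open import Data.List.Membership.Propositional.Properties
  using (∈-map⁺; ∈-map⁻; ∈-++⁺ˡ; ∈-++⁺ʳ; ∈-++⁻; ∈-concat⁺′; ∈-concat⁻′; ∈-filter⁺; ∈-filter⁻; ∈-lookup)
open import Data.List.Membership.DecPropositional _≟_ using (_∈?_)
open import Data.List.Relation.Unary.Any as Any using (here; there)
open import Data.List.Relation.Unary.Any.Properties using (any⁺; any⁻; lookup-index)
open import Data.List.Relation.Unary.All as All using (All)
import Data.List.Relation.Unary.All.Properties as Allₚ
open import Data.List.Relation.Unary.AllPairs using (AllPairs; []; _∷_)
import Data.List.Relation.Unary.AllPairs.Properties as AllPairs
open import Data.List.Relation.Unary.Unique.Propositional using (Unique)
import Data.List.Relation.Unary.Unique.Propositional.Properties as Unique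
open import Data.List.Relation.Binary.Disjoint.Propositional using (Disjoint)
open import Data.List.Relation.Binary.Sublist.Propositional using (_⊆_; []; _∷_; _∷ʳ_; ⊆-trans; minimum)
import Data.List.Relation.Binary.Sublist.Propositional as Sublist
open import Data.List.Relation.Binary.Sublist.Propositional.Properties using (map⁺; filter-⊆)
open import Data.List.Relation.Binary.Subset.Propositional using () renaming (_⊆_ to _⊆ₘ_)
open import Data.Product using (_×_; _,_; proj₁; proj₂; ∃-syntax)
import Data.Product as Product
open import Data.Sum using (_⊎_; inj₁; inj₂; [_,_]′)
import Data.Sum as Sum
open import Data.Unit using (⊤; tt)
open import Function using (_∘_; _⇔_; mk⇔; Equivalence)
open import Function.Construct.Composition using (_⇔-∘_)
open import Function.Construct.Identity using (⇔-id)
open import Function.Construct.Symmetry using (⇔-sym)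
open import Relation.Nullary using (¬_; Dec; does; yes; no)
import Relation.Nullary.Decidable as Dec
open import Relation.Nullary.Decidable using (_×-dec_)
open import Relation.Unary.Properties using (∁?)
open import Relation.Binary.Core using (_⇒_) renaming (_⇔_ to _⇔₂_)
open import Relation.Binary.Definitions using (DecidableEquality)
open import Relation.Binary.Structures using (IsPartialEquivalence)
open import Relation.Binary.PropositionalEquality as ≡ using (_≡_; _≢_; refl; cong; cong₂; subst)
import Relation.Binary.Reasoning.Setoid as SetoidReasoning

private variable
  a b : Level
  A : Set a
  B : Set b

∈ᵇ⁻ : ∀ {n} xs → T (n ∈ᵇ xs) → n ∈ xs
∈ᵇ⁻ {n} xs h = Any.map (ℕ.≡ᵇ⇒≡ n _) (any⁻ (n ≡ᵇ_) xs h)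

∈ᵇ⁺ : ∀ {n xs} → n ∈ xs → T (n ∈ᵇ xs)
∈ᵇ⁺ {n} n∈ = any⁺ (n ≡ᵇ_) (Any.map (ℕ.≡⇒≡ᵇ n _) n∈)

∉ᵇ⁻ : ∀ {n} xs → T (not (n ∈ᵇ xs)) → ¬ n ∈ xs
∉ᵇ⁻ {n} xs h n∈ with n ∈ᵇ xs | ∈ᵇ⁺ {n} {xs} n∈
... | true  | _ = h
... | false | t = t

∉ᵇ⁺ : ∀ {n} xs → ¬ n ∈ xs → T (not (n ∈ᵇ xs))
∉ᵇ⁺ {n} xs n∉ with n ∈ᵇ xs | ∈ᵇ⁻ {n} xs
... | true  | n∈ = n∉ (n∈ _)
... | false | _  = _

meets⁻ : ∀ blk u → T (meets blk u) → ∃[ y ] y ∈ u × y ∈ blk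
meets⁻ blk u h = let y , y∈u , t = find (any⁻ _ u h) in y , y∈u , ∈ᵇ⁻ blk t

meets⁺ : ∀ {blk u y} → y ∈ u → y ∈ blk → T (meets blk u)
meets⁺ y∈u y∈blk = any⁺ _ (lose y∈u (∈ᵇ⁺ y∈blk))

all⁻ : ∀ (p : A → Bool) {xs x} → T (all p xs) → x ∈ xs → T (p x)
all⁻ p {y ∷ _} h (here refl) = proj₁ (Equivalence.to (T-∧ {p y}) h)
all⁻ p {y ∷ _} h (there x∈) = all⁻ p (proj₂ (Equivalence.to (T-∧ {p y}) h)) x∈

all⁺ : ∀ (p : A → Bool) xs → (∀ {x} → x ∈ xs → T (p x)) → T (all p xs)
all⁺ p []       h = _
all⁺ p (x ∷ xs) h = Equivalence.from T-∧ (h (here refl) , all⁺ p xs (h ∘ there))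

∈-⊆ : ∀ {xs ys : List A} {x} → xs ⊆ ys → x ∈ xs → x ∈ ys
∈-⊆ = Sublist.lookup

Unique-⊆ : ∀ {xs ys : List A} → xs ⊆ ys → Unique ys → Unique xs
Unique-⊆ []          u        = u
Unique-⊆ (y ∷ʳ xs⊆)  (_ ∷ u)  = Unique-⊆ xs⊆ u
Unique-⊆ (refl ∷ xs⊆) (x≢ ∷ u) =
  All.tabulate (λ y∈ → All.lookup x≢ (∈-⊆ xs⊆ y∈)) ∷ Unique-⊆ xs⊆ u

Unique-map-⊆ : ∀ (f : A → B) {xs ys} → xs ⊆ ys → Unique (map f ys) → Unique (map f xs)
Unique-map-⊆ f xs⊆ = Unique-⊆ (map⁺ f xs⊆)

Unique-injective : ∀ (f : A → B) {xs} → Unique (map f xs) →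
                   ∀ {x y} → x ∈ xs → y ∈ xs → f x ≡ f y → x ≡ y
Unique-injective f (x≢ ∷ u) (here refl) (here refl) eq = refl
Unique-injective f (x≢ ∷ u) (here refl) (there y∈) eq  = ⊥-elim (All.lookup x≢ (∈-map⁺ f y∈) eq)
Unique-injective f (x≢ ∷ u) (there x∈) (here refl) eq  = ⊥-elim (All.lookup x≢ (∈-map⁺ f x∈) (≡.sym eq))
Unique-injective f (x≢ ∷ u) (there x∈) (there y∈) eq   = Unique-injective f u x∈ y∈ eq

Unique-∈-map⁻ : ∀ (f : A → B) {xs ys} → Unique (map f xs) → (∀ {y} → y ∈ ys → y ∈ xs) →
                ∀ {x} → x ∈ xs → f x ∈ map f ys → x ∈ ys
Unique-∈-map⁻ f u ys⊆xs x∈ fx∈ with y , y∈ , eq ← ∈-map⁻ f fx∈ =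
  subst (_∈ _) (≡.sym (Unique-injective f u x∈ (ys⊆xs y∈) eq)) y∈

sublist-≡ : ∀ {xs ys zs : List A} → Unique xs → ys ⊆ xs → zs ⊆ xs →
            (∀ {y} → y ∈ ys → y ∈ zs) → (∀ {z} → z ∈ zs → z ∈ ys) → ys ≡ zs
sublist-≡ u         []           []           _  _  = refl
sublist-≡ (_ ∷ u)   (x ∷ʳ ys⊆)   (.x ∷ʳ zs⊆)  to fr = sublist-≡ u ys⊆ zs⊆ to fr
sublist-≡ (x≢ ∷ u)  (refl ∷ ys⊆) (refl ∷ zs⊆) to fr = cong (_ ∷_) (sublist-≡ u ys⊆ zs⊆ (tail to ys⊆ x≢) (tail fr zs⊆ x≢))
  where
  tail : ∀ {x vs ws xs} → (∀ {y} → y ∈ x ∷ vs → y ∈ x ∷ ws) → vs ⊆ xs → All.All (x ≢_) xs → ∀ {y} → y ∈ vs → y ∈ ws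
  tail h vs⊆ x≢xs y∈ with h (there y∈)
  ... | here refl = ⊥-elim (All.lookup x≢xs (∈-⊆ vs⊆ y∈) refl)
  ... | there y∈′ = y∈′
sublist-≡ (x≢ ∷ u)  (refl ∷ ys⊆) (x ∷ʳ zs⊆)   to fr = ⊥-elim (All.lookup x≢ (∈-⊆ zs⊆ (to (here refl))) refl)
sublist-≡ (x≢ ∷ u)  (x ∷ʳ ys⊆)   (refl ∷ zs⊆) to fr = ⊥-elim (All.lookup x≢ (∈-⊆ ys⊆ (fr (here refl))) refl)

_≟ₗ_ : DecidableEquality (List ℕ)
_≟ₗ_ = ≡-dec _≟_

put₁ put₂ : A → List A × List A → List A × List A
put₁ x (s , c) = (x ∷ s , c)
put₂ x (s , c) = (s , x ∷ c)

∈-splits⁻ : ∀ (x : A) xs {p} → p ∈ splits (x ∷ xs) →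
            ∃[ q ] q ∈ splits xs × (p ≡ put₁ x q ⊎ p ≡ put₂ x q)
∈-splits⁻ x xs p∈ with ∈-++⁻ (map (put₁ x) (splits xs)) p∈
... | inj₁ p∈₁ = let q , q∈ , eq = ∈-map⁻ (put₁ x) p∈₁ in q , q∈ , inj₁ eq
... | inj₂ p∈₂ = let q , q∈ , eq = ∈-map⁻ (put₂ x) p∈₂ in q , q∈ , inj₂ eq

∈-splits⁺₁ : ∀ (x : A) xs {q} → q ∈ splits xs → put₁ x q ∈ splits (x ∷ xs)
∈-splits⁺₁ x xs q∈ = ∈-++⁺ˡ (∈-map⁺ (put₁ x) q∈)

∈-splits⁺₂ : ∀ (x : A) xs {q} → q ∈ splits xs → put₂ x q ∈ splits (x ∷ xs)
∈-splits⁺₂ x xs q∈ = ∈-++⁺ʳ (map (put₁ x) (splits xs)) (∈-map⁺ (put₂ x) q∈)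

splits-⊆₁ : ∀ (xs : List A) {p} → p ∈ splits xs → proj₁ p ⊆ xs
splits-⊆₁ []       (here refl) = []
splits-⊆₁ (x ∷ xs) p∈ with ∈-splits⁻ x xs p∈
... | q , q∈ , inj₁ refl = refl ∷ splits-⊆₁ xs q∈
... | q , q∈ , inj₂ refl = x ∷ʳ splits-⊆₁ xs q∈

splits-⊆₂ : ∀ (xs : List A) {p} → p ∈ splits xs → proj₂ p ⊆ xs
splits-⊆₂ []       (here refl) = []
splits-⊆₂ (x ∷ xs) p∈ with ∈-splits⁻ x xs p∈
... | q , q∈ , inj₁ refl = x ∷ʳ splits-⊆₂ xs q∈
... | q , q∈ , inj₂ refl = refl ∷ splits-⊆₂ xs q∈

splits-cover : ∀ (xs : List A) {p} → p ∈ splits xs → ∀ {x} → x ∈ xs → x ∈ proj₁ p ⊎ x ∈ proj₂ p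
splits-cover (x ∷ xs) p∈ x∈ with ∈-splits⁻ x xs p∈ | x∈
... | q , q∈ , inj₁ refl | here refl = inj₁ (here refl)
... | q , q∈ , inj₂ refl | here refl = inj₂ (here refl)
... | q , q∈ , inj₁ refl | there y∈ = Sum.map₁ there (splits-cover xs q∈ y∈)
... | q , q∈ , inj₂ refl | there y∈ = Sum.map₂ there (splits-cover xs q∈ y∈)

splits-length : ∀ (xs : List A) {p} → p ∈ splits xs → length (proj₁ p) + length (proj₂ p) ≡ length xs
splits-length []       (here refl) = refl
splits-length (x ∷ xs) p∈ with ∈-splits⁻ x xs p∈
... | q , q∈ , inj₁ refl = cong suc (splits-length xs q∈)
... | q , q∈ , inj₂ refl = ≡.trans (ℕ.+-suc _ _) (cong suc (splits-length xs q∈))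

filter-∈-splits : ∀ (p : A → Bool) xs → (filterᵇ p xs , filterᵇ (not ∘ p) xs) ∈ splits xs
filter-∈-splits p []       = here refl
filter-∈-splits p (x ∷ xs) with p x
... | true  = ∈-splits⁺₁ x xs (filter-∈-splits p xs)
... | false = ∈-splits⁺₂ x xs (filter-∈-splits p xs)

properSplits : List A → List (List A × List A)
properSplits []       = []
properSplits (x ∷ xs) = map (put₁ x) (properSplits xs) ++ map (put₂ x) (splits xs)

splits-proper : ∀ (xs : List A) → splits xs ≡ (xs , []) ∷ properSplits xs
splits-proper []       = refl
splits-proper (x ∷ xs) rewrite splits-proper xs = refl

properSplits-nonempty : ∀ (xs : List A) {p} → p ∈ properSplits xs → ¬ proj₂ p ≡ []
properSplits-nonempty (x ∷ xs) p∈ with ∈-++⁻ (map (put₁ x) (properSplits xs)) p∈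
... | inj₁ p∈₁ = let q , q∈ , eq = ∈-map⁻ (put₁ x) p∈₁ in
                 subst (λ p → ¬ proj₂ p ≡ []) (≡.sym eq) (properSplits-nonempty xs q∈)
... | inj₂ p∈₂ = let q , q∈ , eq = ∈-map⁻ (put₂ x) p∈₂ in
                 subst (λ p → ¬ proj₂ p ≡ []) (≡.sym eq) (λ ())

properSplits-⊆ : ∀ (xs : List A) {p} → p ∈ properSplits xs → p ∈ splits xs
properSplits-⊆ xs p∈ rewrite splits-proper xs = there p∈

properSplits-shorter : ∀ (xs : List A) {p} → p ∈ properSplits xs → length (proj₁ p) < length xs
properSplits-shorter xs {s , []}    p∈ = ⊥-elim (properSplits-nonempty xs p∈ refl)
properSplits-shorter xs {s , _ ∷ c} p∈ =
  subst (length s <_) (splits-length xs (properSplits-⊆ xs p∈)) (ℕ.m<m+n (length s) (s≤s z≤n))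

Unique-splits : ∀ (f : A → B) xs → Unique (map f xs) → Unique (map (map f ∘ proj₁) (splits xs))
Unique-splits f []       u         = All.[] ∷ []
Unique-splits f (x ∷ xs) (x≢ ∷ u) =
  subst Unique (≡.sym (map-++ key (map (put₁ x) sp) (map (put₂ x) sp)))
    (Unique.++⁺ (subst Unique (map-∘ sp) (subst Unique (≡.sym (map-∘ sp)) (Unique.map⁺ ∷-injectiveʳ ih)))
                (subst Unique (map-∘ sp) ih)
                disjoint)
  where
  key = map f ∘ proj₁
  sp = splits xs
  ih = Unique-splits f xs u
  disjoint : Disjoint (map key (map (put₁ x) sp)) (map key (map (put₂ x) sp))
  disjoint (v∈₁ , v∈₂) with ∈-map⁻ key v∈₁ | ∈-map⁻ key v∈₂
  ... | p , p∈ , refl | r , r∈ , eq with ∈-map⁻ (put₁ x) p∈ | ∈-map⁻ (put₂ x) r∈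
  ... | q , _ , refl | q′ , q′∈ , refl =
    All.lookup x≢ (∈-⊆ (map⁺ f (splits-⊆₁ xs q′∈)) (subst (f x ∈_) eq (here refl))) refl

module ListSum {c ℓ} (M : CommutativeMonoid c ℓ) where
  open CommutativeMonoid M renaming (refl to ≈-refl; sym to ≈-sym; trans to ≈-trans)
  open SetoidReasoning setoid

  sum : List Carrier → Carrier
  sum = foldr _∙_ ε

  sum-++ : ∀ xs ys → sum (xs ++ ys) ≈ sum xs ∙ sum ys
  sum-++ []       ys = ≈-sym (identityˡ _)
  sum-++ (x ∷ xs) ys = ≈-trans (∙-congˡ (sum-++ xs ys)) (≈-sym (assoc _ _ _))

  sum-cong : ∀ {f g : A → Carrier} xs → (∀ {x} → x ∈ xs → f x ≈ g x) → sum (map f xs) ≈ sum (map g xs)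
  sum-cong []       h = ≈-refl
  sum-cong (x ∷ xs) h = ∙-cong (h (here refl)) (sum-cong xs (h ∘ there))

  sum-zero : ∀ (f : A → Carrier) xs → (∀ {x} → x ∈ xs → f x ≈ ε) → sum (map f xs) ≈ ε
  sum-zero f []       h = ≈-refl
  sum-zero f (x ∷ xs) h = ≈-trans (∙-cong (h (here refl)) (sum-zero f xs (h ∘ there))) (identityˡ ε)

  sum-∙ : ∀ (f g : A → Carrier) xs → sum (map (λ x → f x ∙ g x) xs) ≈ sum (map f xs) ∙ sum (map g xs)
  sum-∙ f g []       = ≈-sym (identityˡ ε)
  sum-∙ f g (x ∷ xs) = begin
    (f x ∙ g x) ∙ sum (map (λ x → f x ∙ g x) xs)   ≈⟨ ∙-congˡ (sum-∙ f g xs) ⟩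
    (f x ∙ g x) ∙ (sum (map f xs) ∙ sum (map g xs)) ≈⟨ interchange _ _ _ _ ⟩
    (f x ∙ sum (map f xs)) ∙ (g x ∙ sum (map g xs)) ∎
    where open import Algebra.Properties.CommutativeSemigroup commutativeSemigroup using (interchange)

  sum-swap : ∀ (g : A → B → Carrier) xs ys →
             sum (map (λ x → sum (map (g x) ys)) xs) ≈ sum (map (λ y → sum (map (λ x → g x y) xs)) ys)
  sum-swap g []       ys = ≈-sym (sum-zero _ ys (λ _ → ≈-refl))
  sum-swap g (x ∷ xs) ys = ≈-trans (∙-congˡ (sum-swap g xs ys)) (≈-sym (sum-∙ (g x) _ ys))

  sum-splits-∷ : ∀ (f : List A × List A → Carrier) x xs →
                 sum (map f (splits (x ∷ xs))) ≈
                 sum (map (f ∘ put₁ x) (splits xs)) ∙ sum (map (f ∘ put₂ x) (splits xs))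
  sum-splits-∷ f x xs = begin
    sum (map f (map (put₁ x) sp ++ map (put₂ x) sp))
      ≡⟨ cong sum (map-++ f (map (put₁ x) sp) (map (put₂ x) sp)) ⟩
    sum (map f (map (put₁ x) sp) ++ map f (map (put₂ x) sp))
      ≈⟨ sum-++ (map f (map (put₁ x) sp)) _ ⟩
    sum (map f (map (put₁ x) sp)) ∙ sum (map f (map (put₂ x) sp))
      ≡⟨ cong₂ (λ l l′ → sum l ∙ sum l′) (≡.sym (map-∘ sp)) (≡.sym (map-∘ sp)) ⟩
    sum (map (f ∘ put₁ x) sp) ∙ sum (map (f ∘ put₂ x) sp) ∎
    where sp = splits xs

  select : (A → List ℕ) → List ℕ → (A → Carrier) → A → Carrier
  select key k f y = if does (key y ≟ₗ k) then f y else ε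

  sum-select-none : ∀ (key : A → List ℕ) k (f : A → Carrier) ys → (∀ {y} → y ∈ ys → ¬ key y ≡ k) →
                    sum (map (select key k f) ys) ≈ ε
  sum-select-none key k f ys h = sum-zero _ ys drop
    where
    drop : ∀ {y} → y ∈ ys → select key k f y ≈ ε
    drop {y} y∈ with key y ≟ₗ k
    ... | yes eq = ⊥-elim (h y∈ eq)
    ... | no _   = ≈-refl

  sum-select-one : ∀ (key : A → List ℕ) (f : A → Carrier) ys → Unique (map key ys) →
                   ∀ {y₀} → y₀ ∈ ys → sum (map (select key (key y₀) f) ys) ≈ f y₀
  sum-select-one key f (y ∷ ys) (y≢ ∷ u) (here refl) with key y ≟ₗ key y
  ... | no ne = ⊥-elim (ne refl)
  ... | yes _ = ≈-trans (∙-congˡ (sum-select-none key (key y) f ys (λ y′∈ eq → All.lookup y≢ (∈-map⁺ key y′∈) (≡.sym eq))))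
                      (identityʳ _)
  sum-select-one key f (y ∷ ys) (y≢ ∷ u) {y₀} (there y₀∈) with key y ≟ₗ key y₀
  ... | yes eq = ⊥-elim (All.lookup y≢ (∈-map⁺ key y₀∈) eq)
  ... | no _   = ≈-trans (identityˡ _) (sum-select-one key f ys u y₀∈)

module ListSumᴳ {c ℓ} (G : AbelianGroup c ℓ) where
  open AbelianGroup G renaming (refl to ≈-refl; sym to ≈-sym; trans to ≈-trans)
  open ListSum commutativeMonoid public

  sum-⁻¹ : ∀ (f : A → Carrier) xs → sum (map (λ x → f x ⁻¹) xs) ≈ sum (map f xs) ⁻¹
  sum-⁻¹ f []       = ≈-sym ε⁻¹≈ε
    where open import Algebra.Properties.Group group using (ε⁻¹≈ε)
  sum-⁻¹ f (x ∷ xs) = ≈-trans (∙-congˡ (sum-⁻¹ f xs)) (⁻¹-∙-comm _ _)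
    where open import Algebra.Properties.AbelianGroup G using (⁻¹-∙-comm)

sign : List A → ℤ
sign s = (- (+ 1)) ^ length s

sign-∷ : ∀ (x : A) s → sign (x ∷ s) ≡ - sign s
sign-∷ x s = ℤ.-1*i≡-i (sign s)

module SignSums where
  open ListSumᴳ ℤ.+-0-abelianGroup using (sum-cong; sum-zero; sum-splits-∷; sum-⁻¹)
  open ≡.≡-Reasoning

  sum-sign-∷ : ∀ (x : A) xs → sumℤ (map (sign ∘ proj₁) (splits (x ∷ xs))) ≡ + 0
  sum-sign-∷ x xs = begin
    sumℤ (map (sign ∘ proj₁) (splits (x ∷ xs)))
      ≡⟨ sum-splits-∷ (sign ∘ proj₁) x xs ⟩
    sumℤ (map (sign ∘ proj₁ ∘ put₁ x) sp) +ℤ sumℤ (map (sign ∘ proj₁) sp)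
      ≡⟨ cong (_+ℤ sumℤ (map (sign ∘ proj₁) sp)) (≡.trans (sum-cong sp (λ {q} _ → sign-∷ x (proj₁ q))) (sum-⁻¹ (sign ∘ proj₁) sp)) ⟩
    - sumℤ (map (sign ∘ proj₁) sp) +ℤ sumℤ (map (sign ∘ proj₁) sp)
      ≡⟨ ℤ.+-inverseˡ (sumℤ (map (sign ∘ proj₁) sp)) ⟩
    + 0 ∎
    where sp = splits xs

  if-sum : ∀ b (F : A → ℤ) xs →
           (if b then sumℤ (map F xs) else + 0) ≡ sumℤ (map (λ x → if b then F x else + 0) xs)
  if-sum true  F xs = refl
  if-sum false F xs = ≡.sym (sum-zero _ xs (λ _ → refl))

-- Relations on atoms and partitions into blocks

AtomRel : Set₁
AtomRel = ℕ → ℕ → Set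

SameBlock : List (List ℕ) → AtomRel
SameBlock Q a b = ∃[ blk ] blk ∈ Q × a ∈ blk × b ∈ blk

Near : AtomRel → List ℕ → ℕ → Set
Near R w a = ∃[ z ] z ∈ w × R a z

-- R with all classes meeting w merged into one
glue : AtomRel → List ℕ → AtomRel
glue R w a b = R a b ⊎ (Near R w a × Near R w b)

⇔₂-trans : ∀ {R R′ R″ : AtomRel} → R ⇔₂ R′ → R′ ⇔₂ R″ → R ⇔₂ R″
⇔₂-trans (f , g) (f′ , g′) = (λ r → f′ (f r)) , (λ r → g (g′ r))

⇔₂-sym : ∀ {R R′ : AtomRel} → R ⇔₂ R′ → R′ ⇔₂ R
⇔₂-sym (f , g) = g , f

glue-mono : ∀ {R R′ : AtomRel} {w} → R ⇒ R′ → glue R w ⇒ glue R′ w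
glue-mono f (inj₁ r)         = inj₁ (f r)
glue-mono f (inj₂ ((z , z∈ , r) , (z′ , z′∈ , r′))) = inj₂ ((z , z∈ , f r) , (z′ , z′∈ , f r′))

glue-along : ∀ {R : AtomRel} {w w′} → (∀ {x} → Near R w x → Near R w′ x) → glue R w ⇒ glue R w′
glue-along near (inj₁ r)         = inj₁ r
glue-along near (inj₂ (na , nb)) = inj₂ (near na , near nb)

glue-cong : ∀ {R R′ : AtomRel} {w} → R ⇔₂ R′ → glue R w ⇔₂ glue R′ w
glue-cong {R} {R′} (f , g) = glue-mono {R} {R′} f , glue-mono {R′} {R} g

shared-atom-≡ : ∀ {P : List (List ℕ)} → AllPairs Disjoint P →
                ∀ {b b′ a} → b ∈ P → b′ ∈ P → a ∈ b → a ∈ b′ → b ≡ b′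
shared-atom-≡ (_ ∷ _)  (here refl) (here refl) _  _   = refl
shared-atom-≡ (d ∷ _)  (here refl) (there b′∈) a∈ a∈′ = ⊥-elim (All.lookup d b′∈ (a∈ , a∈′))
shared-atom-≡ (d ∷ _)  (there b∈) (here refl)  a∈ a∈′ = ⊥-elim (All.lookup d b∈ (a∈′ , a∈))
shared-atom-≡ (_ ∷ ds) (there b∈) (there b′∈)  a∈ a∈′ = shared-atom-≡ ds b∈ b′∈ a∈ a∈′

nonempty-atom : ∀ {u : List ℕ} → ¬ u ≡ [] → ∃[ y ] y ∈ u
nonempty-atom {[]}    h = ⊥-elim (h refl)
nonempty-atom {y ∷ _} h = y , here refl

AllPairs-Disjoint⇒index : ∀ (P : List (List ℕ)) → AllPairs Disjoint P →
                          ∀ (i j : Fin (length P)) a → a ∈ lookup P i → a ∈ lookup P j → i ≡ j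
AllPairs-Disjoint⇒index (b ∷ P) d        fzero    fzero    a p q = refl
AllPairs-Disjoint⇒index (b ∷ P) (d ∷ _)  fzero    (fsuc j) a p q = ⊥-elim (All.lookup d (∈-lookup j) (p , q))
AllPairs-Disjoint⇒index (b ∷ P) (d ∷ _)  (fsuc i) fzero    a p q = ⊥-elim (All.lookup d (∈-lookup i) (q , p))
AllPairs-Disjoint⇒index (b ∷ P) (_ ∷ ds) (fsuc i) (fsuc j) a p q = cong fsuc (AllPairs-Disjoint⇒index P ds i j a p q)

index⇒AllPairs-Disjoint : ∀ (P : List (List ℕ)) → (∀ (i j : Fin (length P)) a → a ∈ lookup P i → a ∈ lookup P j → i ≡ j) →
                          AllPairs Disjoint P
index⇒AllPairs-Disjoint []      h = []
index⇒AllPairs-Disjoint (b ∷ P) h =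
  All.tabulate (λ b′∈ (a∈ , a∈′) → distinct (h fzero (fsuc (Any.index b′∈)) _ a∈ (subst (_ ∈_) (lookup-index b′∈) a∈′)))
  ∷ index⇒AllPairs-Disjoint P (λ i j a p q → Fin.suc-injective (h (fsuc i) (fsuc j) a p q))
  where
  distinct : ∀ {n} {j : Fin n} → ¬ fzero ≡ fsuc j
  distinct ()

SameBlock-match : ∀ {Q₁ Q₂} → AllPairs Disjoint Q₁ → AllPairs Disjoint Q₂ → SameBlock Q₁ ⇔₂ SameBlock Q₂ →
                  ∀ {u} → u ∈ Q₁ → ¬ u ≡ [] → ∃[ v ] v ∈ Q₂ × u ≐ v
SameBlock-match {Q₁} {Q₂} d₁ d₂ (f , g) {u} u∈ u≢[]
  with y , y∈u ← nonempty-atom u≢[]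
  with v , v∈ , y∈v , _ ← f (u , u∈ , y∈u , y∈u) =
  v , v∈ , λ a → to a , from a
  where
  to : ∀ a → a ∈ u → a ∈ v
  to a a∈ with v′ , v′∈ , y∈v′ , a∈v′ ← f (u , u∈ , y∈u , a∈) =
    subst (a ∈_) (shared-atom-≡ d₂ v′∈ v∈ y∈v′ y∈v) a∈v′
  from : ∀ a → a ∈ v → a ∈ u
  from a a∈ with u′ , u′∈ , y∈u′ , a∈u′ ← g (v , v∈ , y∈v , a∈) =
    subst (a ∈_) (shared-atom-≡ d₁ u′∈ u∈ y∈u′ y∈u) a∈u′

SameBlock? : ∀ Q a b → Dec (SameBlock Q a b)
SameBlock? Q a b =
  Dec.map′ (λ any → let blk , blk∈ , a∈b = find any in blk , blk∈ , a∈b)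
           (λ (blk , blk∈ , a∈b) → lose blk∈ a∈b)
           (Any.any? (λ blk → (a ∈? blk) ×-dec (b ∈? blk)) Q)

Near? : ∀ {R : AtomRel} → (∀ a b → Dec (R a b)) → ∀ w a → Dec (Near R w a)
Near? R? w a = Dec.map′ find (λ (z , z∈ , r) → lose z∈ r) (Any.any? (R? a) w)

Near-++⁻ : ∀ {R : AtomRel} u {v a} → Near R (u ++ v) a → Near R u a ⊎ Near R v a
Near-++⁻ u (z , z∈ , r) = Sum.map (λ z∈u → z , z∈u , r) (λ z∈v → z , z∈v , r) (∈-++⁻ u z∈)

Near-++⁺ : ∀ {R : AtomRel} u {v a} → Near R u a ⊎ Near R v a → Near R (u ++ v) a
Near-++⁺ u (inj₁ (z , z∈ , r)) = z , ∈-++⁺ˡ z∈ , r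
Near-++⁺ u (inj₂ (z , z∈ , r)) = z , ∈-++⁺ʳ u z∈ , r

module Chromatic {c ℓ} (G : Group c ℓ) where
  open GainGraphs G

  chromaticGroup : AbelianGroup c (c ⊔ ℓ)
  chromaticGroup = record
    { Carrier = Expr ; _≈_ = _∼_ ; _∙_ = _⊕_ ; ε = 0# ; _⁻¹ = ⊝_
    ; isAbelianGroup = record
      { isGroup = record
        { isMonoid = record
          { isSemigroup = record
            { isMagma = record
              { isEquivalence = record { refl = ∼-refl ; sym = ∼-sym ; trans = ∼-trans }
              ; ∙-cong = ⊕-cong }
            ; assoc = ⊕-assoc }
          ; identity = ⊕-idˡ , λ x → ∼-trans (⊕-comm x 0#) (⊕-idˡ x) }
        ; inverse = ⊝-invˡ , λ x → ∼-trans (⊕-comm x (⊝ x)) (⊝-invˡ x)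
        ; ⁻¹-cong = ⊝-cong }
      ; comm = ⊕-comm } }

  open AbelianGroup chromaticGroup public
    using (∙-congˡ; ∙-congʳ; identityˡ; identityʳ; inverseʳ) renaming (reflexive to ≡⇒∼)
  open import Algebra.Properties.Group (AbelianGroup.group chromaticGroup) public
    using (ε⁻¹≈ε; ⁻¹-involutive)
  open import Algebra.Properties.AbelianGroup chromaticGroup public using (⁻¹-∙-comm)
  open import Algebra.Properties.CommutativeSemigroup (AbelianGroup.commutativeSemigroup chromaticGroup) public
    using (interchange)
  open ListSumᴳ chromaticGroup public
  open SetoidReasoning (AbelianGroup.setoid chromaticGroup)

  rep-cong : ∀ n {x y} → x ∼ y → rep n x ∼ rep n y
  rep-cong zero    p = ∼-refl
  rep-cong (suc n) p = ⊕-cong p (rep-cong n p)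

  rep-+ : ∀ m n x → rep (m + n) x ∼ rep m x ⊕ rep n x
  rep-+ zero    n x = ∼-sym (identityˡ _)
  rep-+ (suc m) n x = ∼-trans (∙-congˡ (rep-+ m n x)) (∼-sym (⊕-assoc _ _ _))

  rep-⊕ : ∀ n x y → rep n (x ⊕ y) ∼ rep n x ⊕ rep n y
  rep-⊕ zero    x y = ∼-sym (identityˡ 0#)
  rep-⊕ (suc n) x y = ∼-trans (∙-congˡ (rep-⊕ n x y)) (interchange x y (rep n x) (rep n y))

  rep-0# : ∀ n → rep n 0# ∼ 0#
  rep-0# zero    = ∼-refl
  rep-0# (suc n) = ∼-trans (identityˡ _) (rep-0# n)

  ⊖-· : ∀ m n x → (m ⊖ n) · x ∼ rep m x ⊕ ⊝ rep n x
  ⊖-· m       zero    x = ∼-sym (∼-trans (∙-congˡ ε⁻¹≈ε) (identityʳ _))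
  ⊖-· zero    (suc n) x = ∼-sym (identityˡ _)
  ⊖-· (suc m) (suc n) x rewrite ℤ.[1+m]⊖[1+n]≡m⊖n m n = begin
    (m ⊖ n) · x                               ≈⟨ ⊖-· m n x ⟩
    rep m x ⊕ ⊝ rep n x                       ≈⟨ ∼-sym (identityˡ _) ⟩
    0# ⊕ (rep m x ⊕ ⊝ rep n x)                ≈⟨ ∙-congʳ (∼-sym (inverseʳ x)) ⟩
    (x ⊕ ⊝ x) ⊕ (rep m x ⊕ ⊝ rep n x)         ≈⟨ interchange x (⊝ x) (rep m x) (⊝ rep n x) ⟩
    (x ⊕ rep m x) ⊕ (⊝ x ⊕ ⊝ rep n x)         ≈⟨ ∙-congˡ (⁻¹-∙-comm x (rep n x)) ⟩
    (x ⊕ rep m x) ⊕ ⊝ (x ⊕ rep n x)           ∎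

  ·-cong : ∀ z {x y} → x ∼ y → z · x ∼ z · y
  ·-cong (+ n)    p = rep-cong n p
  ·-cong -[1+ n ] p = ⊝-cong (rep-cong (suc n) p)

  ·-distribʳ : ∀ a b x → (a +ℤ b) · x ∼ a · x ⊕ b · x
  ·-distribʳ (+ m)    (+ n)    x = rep-+ m n x
  ·-distribʳ (+ m)    -[1+ n ] x = ⊖-· m (suc n) x
  ·-distribʳ -[1+ m ] (+ n)    x = ∼-trans (⊖-· n (suc m) x) (⊕-comm _ _)
  ·-distribʳ -[1+ m ] -[1+ n ] x = begin
    ⊝ rep (suc (suc (m + n))) x   ≡⟨ cong (λ k → ⊝ rep (suc k) x) (ℕ.+-suc m n) ⟨
    ⊝ rep (suc m + suc n) x       ≈⟨ ⊝-cong (rep-+ (suc m) (suc n) x) ⟩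
    ⊝ (rep (suc m) x ⊕ rep (suc n) x)      ≈⟨ ⁻¹-∙-comm _ _ ⟨
    ⊝ rep (suc m) x ⊕ ⊝ rep (suc n) x      ∎

  ·-distribˡ : ∀ z x y → z · (x ⊕ y) ∼ z · x ⊕ z · y
  ·-distribˡ (+ n)    x y = rep-⊕ n x y
  ·-distribˡ -[1+ n ] x y = ∼-trans (⊝-cong (rep-⊕ (suc n) x y)) (∼-sym (⁻¹-∙-comm _ _))

  ·-zeroʳ : ∀ z → z · 0# ∼ 0#
  ·-zeroʳ (+ n)    = rep-0# n
  ·-zeroʳ -[1+ n ] = ∼-trans (⊝-cong (rep-0# (suc n))) ε⁻¹≈ε

  ⊝-· : ∀ z x → ⊝ (z · x) ∼ (- z) · x
  ⊝-· (+ zero)  x = ε⁻¹≈ε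
  ⊝-· (+ suc n) x = ∼-refl
  ⊝-· -[1+ n ]  x = ⁻¹-involutive _

  sumℤ-· : ∀ zs x → sumℤ zs · x ∼ Σᴱ (map (_· x) zs)
  sumℤ-· []       x = ∼-refl
  sumℤ-· (z ∷ zs) x = ∼-trans (·-distribʳ z (sumℤ zs) x) (∙-congˡ (sumℤ-· zs x))

  ·-Σᴱ : ∀ z xs → z · Σᴱ xs ∼ Σᴱ (map (z ·_) xs)
  ·-Σᴱ z []       = ·-zeroʳ z
  ·-Σᴱ z (x ∷ xs) = ∼-trans (·-distribˡ z x _) (∙-congˡ (·-Σᴱ z xs))

  sum-fibres : ∀ {a b} {A : Set a} {B : Set b} (key : A → List ℕ) (φ : B → A) (w : B → ℤ) (x : A → Expr) xs ys →
               Unique (map key ys) → (∀ {p} → p ∈ xs → φ p ∈ ys) →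
               Σᴱ (map (λ p → w p · x (φ p)) xs) ∼
               Σᴱ (map (λ y → sumℤ (map (λ p → if does (key y ≟ₗ key (φ p)) then w p else + 0) xs) · x y) ys)
  sum-fibres key φ w x xs ys u φ∈ = begin
    Σᴱ (map (λ p → w p · x (φ p)) xs)
      ≈⟨ sum-cong xs (λ p∈ → ·-cong (w _) (∼-sym (sum-select-one key x ys u (φ∈ p∈)))) ⟩
    Σᴱ (map (λ p → w p · Σᴱ (map (select key (key (φ p)) x) ys)) xs)
      ≈⟨ sum-cong xs (λ {p} _ → ∼-trans (·-Σᴱ (w p) (map (select key (key (φ p)) x) ys))
                                        (≡⇒∼ (cong Σᴱ (≡.sym (map-∘ {g = w p ·_} {f = select key (key (φ p)) x} ys))))) ⟩
    Σᴱ (map (λ p → Σᴱ (map (λ y → w p · select key (key (φ p)) x y) ys)) xs)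
      ≈⟨ sum-cong xs (λ {p} _ → sum-cong ys (λ {y} _ → weight-select p y)) ⟩
    Σᴱ (map (λ p → Σᴱ (map (λ y → weight p y · x y) ys)) xs)
      ≈⟨ sum-swap (λ p y → weight p y · x y) xs ys ⟩
    Σᴱ (map (λ y → Σᴱ (map (λ p → weight p y · x y) xs)) ys)
      ≈⟨ sum-cong ys (λ {y} _ → ∼-trans (≡⇒∼ (cong Σᴱ (map-∘ xs))) (∼-sym (sumℤ-· (map (λ p → weight p y) xs) (x y)))) ⟩
    Σᴱ (map (λ y → sumℤ (map (λ p → weight p y) xs) · x y) ys) ∎
    where
    weight : _ → _ → ℤ
    weight p y = if does (key y ≟ₗ key (φ p)) then w p else + 0
    weight-select : ∀ p y → w p · select key (key (φ p)) x y ∼ weight p y · x y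
    weight-select p y with key y ≟ₗ key (φ p)
    ... | yes _ = ∼-refl
    ... | no _  = ·-zeroʳ (w p)

module Blocks {c ℓ} (G : Group c ℓ) where
  open GainGraphs G

  ends : Edge → List ℕ
  ends e = src e ++ tgt e

  join : AtomRel → Edge → AtomRel
  join R e = glue R (ends e)

  blockOf⁻ : ∀ Q w {a} → a ∈ blockOf Q w → Near (SameBlock Q) w a
  blockOf⁻ Q w a∈ =
    let blk , a∈blk , blk∈ = ∈-concat⁻′ _ a∈
        blk∈Q , t = ∈-filter⁻ (T? ∘ λ b → meets b w) blk∈
        y , y∈w , y∈blk = meets⁻ blk w t
    in y , y∈w , blk , blk∈Q , a∈blk , y∈blk

  blockOf⁺ : ∀ Q w {a} → Near (SameBlock Q) w a → a ∈ blockOf Q w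
  blockOf⁺ Q w (y , y∈w , blk , blk∈Q , a∈blk , y∈blk) =
    ∈-concat⁺′ a∈blk (∈-filter⁺ (T? ∘ λ b → meets b w) blk∈Q (meets⁺ y∈w y∈blk))

  blockOf-unique : ∀ P → AllPairs Disjoint P → ∀ {blk w} → blk ∈ P → (∀ {a} → a ∈ w → a ∈ blk) → ¬ w ≡ [] →
                   blockOf P w ≡ blk
  blockOf-unique P d {blk} {w} blk∈ w⊆ w≢[] with y , y∈w ← nonempty-atom w≢[] =
    ≡.trans (cong concat (only P d blk∈)) (++-identityʳ blk)
    where
    only : ∀ P → AllPairs Disjoint P → blk ∈ P → filterᵇ (λ b → meets b w) P ≡ blk ∷ []
    only (b ∷ P) (d ∷ ds) (here refl) =
      ≡.trans (filter-accept (T? ∘ λ b → meets b w) (meets⁺ y∈w (w⊆ y∈w)))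
            (cong (b ∷_) (filter-none (T? ∘ λ b → meets b w)
              (All.tabulate λ b′∈ t → let z , z∈w , z∈b′ = meets⁻ _ w t in All.lookup d b′∈ (w⊆ z∈w , z∈b′))))
    only (b ∷ P) (d ∷ ds) (there blk∈) =
      ≡.trans (filter-reject (T? ∘ λ b → meets b w)
              (λ t → let z , z∈w , z∈b = meets⁻ b w t in All.lookup d blk∈ (z∈b , w⊆ z∈w)))
            (only P ds blk∈)

  hits : Vtx → Vtx → List ℕ → Bool
  hits u v b = meets b u ∨ meets b v

  mergeP-≡ : ∀ u v P → mergeP u v P ≡ concat (filterᵇ (hits u v) P) ∷ filter (∁? (T? ∘ hits u v)) P
  mergeP-≡ u v P rewrite partition-defn (T? ∘ hits u v) P = refl

  private
    hitBlocks⁻ : ∀ u v P {a} → a ∈ concat (filterᵇ (hits u v) P) → Near (SameBlock P) (u ++ v) a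
    hitBlocks⁻ u v P a∈ with blk , a∈blk , blk∈ ← ∈-concat⁻′ _ a∈
                        with blk∈P , t ← ∈-filter⁻ (T? ∘ hits u v) blk∈
                        with Equivalence.to (T-∨ {meets blk u}) t
    ... | inj₁ tu = let z , z∈ , z∈blk = meets⁻ blk u tu in z , ∈-++⁺ˡ z∈ , blk , blk∈P , a∈blk , z∈blk
    ... | inj₂ tv = let z , z∈ , z∈blk = meets⁻ blk v tv in z , ∈-++⁺ʳ u z∈ , blk , blk∈P , a∈blk , z∈blk

    hitBlocks⁺ : ∀ u v P {a} → Near (SameBlock P) (u ++ v) a → a ∈ concat (filterᵇ (hits u v) P)
    hitBlocks⁺ u v P (z , z∈ , blk , blk∈P , a∈blk , z∈blk) =
      ∈-concat⁺′ a∈blk (∈-filter⁺ (T? ∘ hits u v) blk∈P (Equivalence.from T-∨ (hit (∈-++⁻ u z∈))))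
      where
      hit : z ∈ u ⊎ z ∈ v → T (meets blk u) ⊎ T (meets blk v)
      hit (inj₁ z∈u) = inj₁ (meets⁺ z∈u z∈blk)
      hit (inj₂ z∈v) = inj₂ (meets⁺ z∈v z∈blk)

  SameBlock-merge : ∀ u v P → SameBlock (mergeP u v P) ⇔₂ glue (SameBlock P) (u ++ v)
  SameBlock-merge u v P rewrite mergeP-≡ u v P = to , from
    where
    to : SameBlock (concat (filterᵇ (hits u v) P) ∷ filter (∁? (T? ∘ hits u v)) P) ⇒ glue (SameBlock P) (u ++ v)
    to (_ , here refl , a∈ , b∈)  = inj₂ (hitBlocks⁻ u v P a∈ , hitBlocks⁻ u v P b∈)
    to (blk , there blk∈ , a∈ , b∈) = inj₁ (blk , proj₁ (∈-filter⁻ (∁? (T? ∘ hits u v)) blk∈) , a∈ , b∈)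
    from : glue (SameBlock P) (u ++ v) ⇒ SameBlock (concat (filterᵇ (hits u v) P) ∷ filter (∁? (T? ∘ hits u v)) P)
    from (inj₂ (na , nb)) = _ , here refl , hitBlocks⁺ u v P na , hitBlocks⁺ u v P nb
    from (inj₁ (blk , blk∈ , a∈ , b∈)) with T? (hits u v blk)
    ... | yes t = _ , here refl , ∈-concat⁺′ a∈ (∈-filter⁺ (T? ∘ hits u v) blk∈ t)
                                , ∈-concat⁺′ b∈ (∈-filter⁺ (T? ∘ hits u v) blk∈ t)
    ... | no ¬t = blk , there (∈-filter⁺ (∁? (T? ∘ hits u v)) blk∈ ¬t) , a∈ , b∈

  SameBlock-blocks : ∀ S P {R} → SameBlock P ⇔₂ R → SameBlock (blocks P S) ⇔₂ foldl join R S
  SameBlock-blocks []      P P≅R = P≅R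
  SameBlock-blocks (e ∷ S) P P≅R =
    SameBlock-blocks S (mergeP (src e) (tgt e) P) (⇔₂-trans (SameBlock-merge (src e) (tgt e) P) (glue-cong P≅R))

  record Coarsening (Vs : List Vtx) (P : List (List ℕ)) : Set where
    field
      disjoint : AllPairs Disjoint P
      nonempty : ∀ {b} → b ∈ P → ¬ b ≡ []
      covers   : ∀ {u} → u ∈ Vs → ∃[ b ] b ∈ P × (∀ {a} → a ∈ u → a ∈ b)

  Coarsening-refl : ∀ X → WF X → Coarsening (V X) (V X)
  Coarsening-refl X wf = record
    { disjoint = index⇒AllPairs-Disjoint (V X) (WF.disjoint wf)
    ; nonempty = All.lookup (WF.nonempty wf)
    ; covers   = λ {u} u∈ → u , u∈ , λ a∈ → a∈
    }

  Coarsening-merge : ∀ {Vs P u} v → All (λ w → ¬ w ≡ []) Vs → u ∈ Vs → Coarsening Vs P → Coarsening Vs (mergeP u v P)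
  Coarsening-merge {Vs} {P} {u} v Vs≢[] u∈ C = subst (Coarsening Vs) (≡.sym (mergeP-≡ u v P)) (record
    { disjoint = All.tabulate separated ∷ AllPairs.filter⁺ Hᶜ? disjoint
    ; nonempty = nonempty′
    ; covers   = covers′
    })
    where
    open Coarsening C
    H? = T? ∘ hits u v
    Hᶜ? = ∁? H?
    separated : ∀ {b′} → b′ ∈ filter Hᶜ? P → Disjoint (concat (filterᵇ (hits u v) P)) b′
    separated b′∈ (a∈ , a∈′) with blk , a∈blk , blk∈ ← ∈-concat⁻′ _ a∈
                             with blk∈P , t ← ∈-filter⁻ H? blk∈
                             with b′∈P , ¬t ← ∈-filter⁻ Hᶜ? b′∈ =
      ¬t (subst (T ∘ hits u v) (shared-atom-≡ disjoint blk∈P b′∈P a∈blk a∈′) t)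
    nonempty′ : ∀ {b} → b ∈ concat (filterᵇ (hits u v) P) ∷ filter Hᶜ? P → ¬ b ≡ []
    nonempty′ (there b∈) = nonempty (proj₁ (∈-filter⁻ Hᶜ? b∈))
    nonempty′ (here refl) eq with y , y∈u ← nonempty-atom (All.lookup Vs≢[] u∈)
                              with blk , blk∈ , u⊆ ← covers u∈ =
      ∉[] (subst (y ∈_) eq (∈-concat⁺′ (u⊆ y∈u) (∈-filter⁺ H? blk∈ (Equivalence.from T-∨ (inj₁ (meets⁺ y∈u (u⊆ y∈u)))))))
      where ∉[] : y ∈ [] → ⊥
            ∉[] ()
    covers′ : ∀ {w} → w ∈ Vs → ∃[ b ] b ∈ concat (filterᵇ (hits u v) P) ∷ filter Hᶜ? P × (∀ {a} → a ∈ w → a ∈ b)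
    covers′ w∈ with blk , blk∈ , w⊆ ← covers w∈ | H? blk
    ... | yes t = _ , here refl , λ a∈ → ∈-concat⁺′ (w⊆ a∈) (∈-filter⁺ H? blk∈ t)
    ... | no ¬t = blk , there (∈-filter⁺ Hᶜ? blk∈ ¬t) , w⊆

  Coarsening-blocks : ∀ {Vs} S P → All (λ w → ¬ w ≡ []) Vs → (∀ {e} → e ∈ S → src e ∈ Vs) →
                      Coarsening Vs P → Coarsening Vs (blocks P S)
  Coarsening-blocks []      P Vs≢[] S⊆ C = C
  Coarsening-blocks (e ∷ S) P Vs≢[] S⊆ C =
    Coarsening-blocks S _ Vs≢[] (S⊆ ∘ there) (Coarsening-merge (tgt e) Vs≢[] (S⊆ (here refl)) C)

  WF-delete : ∀ X ls → WF X → WF (delete ls X)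
  WF-delete X ls wf = record
    { nonempty = WF.nonempty wf
    ; disjoint = WF.disjoint wf
    ; srcV     = Allₚ.filter⁺ keep? (WF.srcV wf)
    ; tgtV     = Allₚ.filter⁺ keep? (WF.tgtV wf)
    ; uniqueL  = Unique-map-⊆ lbl (filter-⊆ keep? (E X)) (WF.uniqueL wf)
    }
    where
    keep? = T? ∘ λ e → not (lbl e ∈ᵇ ls)

  WF-contract : ∀ X S → WF X → (∀ {e} → e ∈ S → e ∈ E X) → WF (contract X S)
  WF-contract X S wf S⊆ = record
    { nonempty = All.tabulate (Coarsening.nonempty C)
    ; disjoint = AllPairs-Disjoint⇒index P (Coarsening.disjoint C)
    ; srcV     = Allₚ.map⁺ (Allₚ.filter⁺ keep? (All.map endpoint (WF.srcV wf)))
    ; tgtV     = Allₚ.map⁺ (Allₚ.filter⁺ keep? (All.map endpoint (WF.tgtV wf)))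
    ; uniqueL  = subst Unique (map-∘ _) (Unique-map-⊆ lbl (filter-⊆ keep? (E X)) (WF.uniqueL wf))
    }
    where
    P = blocks (V X) S
    keep? = T? ∘ λ e → not (lbl e ∈ᵇ labels S)
    C : Coarsening (V X) P
    C = Coarsening-blocks S (V X) (WF.nonempty wf) (λ e∈ → All.lookup (WF.srcV wf) (S⊆ e∈)) (Coarsening-refl X wf)
    endpoint : ∀ {w} → w ∈ V X → blockOf P w ∈ P
    endpoint w∈ with blk , blk∈ , w⊆ ← Coarsening.covers C w∈ =
      subst (_∈ P) (≡.sym (blockOf-unique P (Coarsening.disjoint C) blk∈ w⊆ (All.lookup (WF.nonempty wf) w∈))) blk∈

  ∈-delete⁻ : ∀ ls X {f} → f ∈ E (delete ls X) → f ∈ E X × ¬ lbl f ∈ ls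
  ∈-delete⁻ ls X f∈ = Product.map₂ (∉ᵇ⁻ ls) (∈-filter⁻ (T? ∘ λ e → not (lbl e ∈ᵇ ls)) f∈)

  ∈-delete⁺ : ∀ ls X {f} → f ∈ E X → ¬ lbl f ∈ ls → f ∈ E (delete ls X)
  ∈-delete⁺ ls X f∈ f∉ = ∈-filter⁺ (T? ∘ λ e → not (lbl e ∈ᵇ ls)) f∈ (∉ᵇ⁺ ls f∉)

  contractEdge : List (List ℕ) → Edge → Edge
  contractEdge P f = edge (lbl f) (blockOf P (src f)) (blockOf P (tgt f)) (gain f)

  ∈-contract⁻ : ∀ X S {f} → f ∈ E (contract X S) →
                ∃[ f₀ ] f₀ ∈ E X × ¬ lbl f₀ ∈ labels S × f ≡ contractEdge (blocks (V X) S) f₀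
  ∈-contract⁻ X S f∈ with f₀ , f₀∈ , refl ← ∈-map⁻ (contractEdge (blocks (V X) S)) f∈ =
    f₀ , ∈-delete⁻ (labels S) X f₀∈ .proj₁ , ∈-delete⁻ (labels S) X f₀∈ .proj₂ , refl

  ∈-contract⁺ : ∀ X S {f₀} → f₀ ∈ E X → ¬ lbl f₀ ∈ labels S → contractEdge (blocks (V X) S) f₀ ∈ E (contract X S)
  ∈-contract⁺ X S f₀∈ f₀∉ = ∈-map⁺ (contractEdge (blocks (V X) S)) (∈-delete⁺ (labels S) X f₀∈ f₀∉)

module Minors {c ℓ} (G : Group c ℓ) (Φ : GainGraphs.GG G) (wfΦ : GainGraphs.WF G Φ) where
  open Group G using (_≈_) renaming (refl to ≈-refl)
  open GainGraphs G
  open Blocks G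

  srcV : ∀ {e} → e ∈ E Φ → src e ∈ V Φ
  srcV = All.lookup (WF.srcV wfΦ)

  tgtV : ∀ {e} → e ∈ E Φ → tgt e ∈ V Φ
  tgtV = All.lookup (WF.tgtV wfΦ)

  disjointΦ : AllPairs Disjoint (V Φ)
  disjointΦ = index⇒AllPairs-Disjoint (V Φ) (WF.disjoint wfΦ)

  record Admissible (R : AtomRel) : Set where
    field
      isPartialEquivalence : IsPartialEquivalence R
      coarse               : SameBlock (V Φ) ⇒ R
    open IsPartialEquivalence isPartialEquivalence public

    sameVertex : ∀ {w z z′} → w ∈ V Φ → z ∈ w → z′ ∈ w → R z z′
    sameVertex w∈ z∈ z′∈ = coarse (_ , w∈ , z∈ , z′∈)

  Admissible-SameBlock : Admissible (SameBlock (V Φ))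
  Admissible-SameBlock = record
    { isPartialEquivalence = record
      { sym   = λ (blk , blk∈ , a∈ , b∈) → blk , blk∈ , b∈ , a∈
      ; trans = λ (blk , blk∈ , a∈ , b∈) (blk′ , blk′∈ , b∈′ , d∈) →
                  blk , blk∈ , a∈ , subst (_ ∈_) (shared-atom-≡ disjointΦ blk′∈ blk∈ b∈′ b∈) d∈
      }
    ; coarse = λ r → r
    }

  Admissible-join : ∀ {R} e → Admissible R → Admissible (join R e)
  Admissible-join {R} e A = record
    { isPartialEquivalence = record { sym = sym′ ; trans = trans′ }
    ; coarse = inj₁ ∘ coarse
    }
    where
    open Admissible A
    near : ∀ {x y} → Near R (ends e) x → R x y → Near R (ends e) y
    near (z , z∈ , r) s = z , z∈ , trans (sym s) r
    sym′ : ∀ {a b} → join R e a b → join R e b a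
    sym′ (inj₁ r)       = inj₁ (sym r)
    sym′ (inj₂ (p , q)) = inj₂ (q , p)
    trans′ : ∀ {a b d} → join R e a b → join R e b d → join R e a d
    trans′ (inj₁ r)       (inj₁ s)         = inj₁ (trans r s)
    trans′ (inj₁ r)       (inj₂ (p , q))   = inj₂ (near p (sym r) , q)
    trans′ (inj₂ (p , q)) (inj₁ s)         = inj₂ (p , near q s)
    trans′ (inj₂ (p , _)) (inj₂ (_ , q′))  = inj₂ (p , q′)

  Admissible-foldl : ∀ S {R} → Admissible R → Admissible (foldl join R S)
  Admissible-foldl []      A = A
  Admissible-foldl (e ∷ S) A = Admissible-foldl S (Admissible-join e A)

  -- atoms joined by a path of S-edges, i.e. lying in one block of π(S)
  Linked : List Edge → AtomRel
  Linked S = foldl join (SameBlock (V Φ)) S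

  Admissible-Linked : ∀ S → Admissible (Linked S)
  Admissible-Linked S = Admissible-foldl S Admissible-SameBlock

  SameBlock-Linked : ∀ S → SameBlock (blocks (V Φ) S) ⇔₂ Linked S
  SameBlock-Linked S = SameBlock-blocks S (V Φ) ((λ r → r) , (λ r → r))

  Linked-snoc : ∀ S e → join (Linked S) e ⇔₂ Linked (S ++ e ∷ [])
  Linked-snoc S e = subst (join (Linked S) e ⇔₂_) (≡.sym (foldl-++ join (SameBlock (V Φ)) S (e ∷ []))) ((λ r → r) , (λ r → r))

  Saturation : AtomRel → List ℕ → List ℕ → Set
  Saturation R w₀ w = ∀ a → (a ∈ w → Near R w₀ a) × (Near R w₀ a → a ∈ w)

  Saturation-unique : ∀ {R w₀ w w′} → Saturation R w₀ w → Saturation R w₀ w′ → w ≐ w′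
  Saturation-unique h h′ a = proj₂ (h′ a) ∘ proj₁ (h a) , proj₂ (h a) ∘ proj₁ (h′ a)

  Saturation-resp : ∀ {R R′ w₀ w} → R ⇔₂ R′ → Saturation R w₀ w → Saturation R′ w₀ w
  Saturation-resp (f , g) h a =
    (λ a∈ → let z , z∈ , r = proj₁ (h a) a∈ in z , z∈ , f r) ,
    (λ (z , z∈ , r) → proj₂ (h a) (z , z∈ , g r))

  Saturation-self : ∀ {w} → w ∈ V Φ → Saturation (SameBlock (V Φ)) w w
  Saturation-self {w} w∈ a =
    (λ a∈ → a , a∈ , w , w∈ , a∈ , a∈) ,
    (λ (z , z∈ , blk , blk∈ , a∈ , z∈blk) → subst (a ∈_) (shared-atom-≡ disjointΦ blk∈ w∈ z∈blk z∈) a∈)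

  Near-saturation : ∀ {R} → Admissible R → ∀ {w₀ w} → w₀ ∈ V Φ → Saturation R w₀ w →
                    ∀ {x} → (Near R w x → Near R w₀ x) × (Near R w₀ x → Near R w x)
  Near-saturation A w₀∈ h =
    (λ (z , z∈ , r) → let z₀ , z₀∈ , r′ = proj₁ (h z) z∈ in z₀ , z₀∈ , trans r r′) ,
    (λ (z , z∈ , r) → z , proj₂ (h z) (z , z∈ , sameVertex w₀∈ z∈ z∈) , r)
    where open Admissible A

  Image : AtomRel → Edge → Edge → Set c
  Image R e f = lbl f ≡ lbl e × gain f ≡ gain e × Saturation R (src e) (src f) × Saturation R (tgt e) (tgt f)

  Image-resp : ∀ {R R′ e f} → R ⇔₂ R′ → Image R e f → Image R′ e f
  Image-resp R⇔R′ (l , g , s , t) = l , g , Saturation-resp R⇔R′ s , Saturation-resp R⇔R′ t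

  -- X is the minor of Φ with vertex blocks the classes of R and edges the images of the K-edges of Φ
  record Represents (R : AtomRel) (K : Edge → Set) (X : GG) : Set c where
    field
      vertices : SameBlock (V X) ⇔₂ R
      image    : ∀ {f} → f ∈ E X → ∃[ e ] e ∈ E Φ × K e × Image R e f
      preimage : ∀ {e} → e ∈ E Φ → K e → ∃[ f ] f ∈ E X × Image R e f

  Represents-resp : ∀ {R R′ K K′ X} → R ⇔₂ R′ → (∀ {e} → e ∈ E Φ → K e ⇔ K′ e) →
                    Represents R K X → Represents R′ K′ X
  Represents-resp R⇔R′ K⇔K′ rX = record
    { vertices = ⇔₂-trans vertices R⇔R′
    ; image    = λ f∈ → let e , e∈ , k , im = image f∈ in e , e∈ , Equivalence.to (K⇔K′ e∈) k , Image-resp R⇔R′ im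
    ; preimage = λ e∈ k → let f , f∈ , im = preimage e∈ (Equivalence.from (K⇔K′ e∈) k) in f , f∈ , Image-resp R⇔R′ im
    }
    where open Represents rX

  Represents-≅ : ∀ {R K X Y} → WF X → WF Y → Represents R K X → Represents R K Y → X ≅ Y
  Represents-≅ {X = X} {Y} wX wY rX rY =
    matchV , matchV′ ,
    (λ f f∈ → let g , g∈ , l , s , t , q = matchE rX rY f∈ in g , g∈ , l , inj₁ (s , t , q)) ,
    (λ g g∈ → let f , f∈ , l , s , t , q = matchE rY rX g∈ in
              f , f∈ , ≡.sym l , inj₁ (≐-sym s , ≐-sym t , Group.sym G q))
    where
    dX = index⇒AllPairs-Disjoint (V X) (WF.disjoint wX)
    dY = index⇒AllPairs-Disjoint (V Y) (WF.disjoint wY)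
    ≐-sym : ∀ {u v} → u ≐ v → v ≐ u
    ≐-sym h a = proj₂ (h a) , proj₁ (h a)
    X⇔Y : SameBlock (V X) ⇔₂ SameBlock (V Y)
    X⇔Y = ⇔₂-trans (Represents.vertices rX) (⇔₂-sym (Represents.vertices rY))
    matchV : ∀ u → u ∈ V X → ∃[ v ] v ∈ V Y × u ≐ v
    matchV u u∈ = SameBlock-match dX dY X⇔Y u∈ (All.lookup (WF.nonempty wX) u∈)
    matchV′ : ∀ v → v ∈ V Y → ∃[ u ] u ∈ V X × u ≐ v
    matchV′ v v∈ = let u , u∈ , v≐u = SameBlock-match dY dX (⇔₂-sym X⇔Y) v∈ (All.lookup (WF.nonempty wY) v∈)
                   in u , u∈ , ≐-sym v≐u
    matchE : ∀ {X Y R K} → Represents R K X → Represents R K Y → ∀ {f} → f ∈ E X →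
             ∃[ g ] g ∈ E Y × lbl f ≡ lbl g × src f ≐ src g × tgt f ≐ tgt g × gain f ≈ gain g
    matchE rX rY {f} f∈ with e , e∈ , k , lf , gf , sf , tf ← Represents.image rX f∈
                        with g , g∈ , lg , gn , sg , tg ← Represents.preimage rY e∈ k =
      g , g∈ , ≡.trans lf (≡.sym lg) , Saturation-unique sf sg , Saturation-unique tf tg ,
      subst (gain f ≈_) (≡.trans gf (≡.sym gn)) ≈-refl

  Represents-Φ : Represents (SameBlock (V Φ)) (λ _ → ⊤) Φ
  Represents-Φ = record
    { vertices = (λ r → r) , (λ r → r)
    ; image    = λ e∈ → _ , e∈ , _ , refl , refl , Saturation-self (srcV e∈) , Saturation-self (tgtV e∈)
    ; preimage = λ e∈ _ → _ , e∈ , refl , refl , Saturation-self (srcV e∈) , Saturation-self (tgtV e∈)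
    }

  Represents-delete : ∀ {R K X} ls → Represents R K X → Represents R (λ e → K e × ¬ lbl e ∈ ls) (delete ls X)
  Represents-delete {X = X} ls rX = record
    { vertices = vertices
    ; image    = λ f∈ → let f∈X , f∉ = ∈-delete⁻ ls X f∈
                            e , e∈ , k , im@(l , _) = image f∈X
                        in e , e∈ , (k , subst (λ n → ¬ n ∈ ls) l f∉) , im
    ; preimage = λ e∈ (k , e∉) → let f , f∈ , im@(l , _) = preimage e∈ k
                                 in f , ∈-delete⁺ ls X f∈ (subst (λ n → ¬ n ∈ ls) (≡.sym l) e∉) , im
    }
    where open Represents rX

  blockOf-saturation : ∀ {P R R′ w₁ w} → Admissible R → Admissible R′ → SameBlock P ⇔₂ R′ → R ⇒ R′ →
                       w₁ ∈ V Φ → Saturation R w₁ w → Saturation R′ w₁ (blockOf P w)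
  blockOf-saturation {P} {w = w} A A′ (f , g) R⇒R′ w₁∈ h a =
    (λ a∈ → let y , y∈ , same = blockOf⁻ P w a∈
                z , z∈ , r = proj₁ (h y) y∈
            in z , z∈ , Admissible.trans A′ (f same) (R⇒R′ r)) ,
    (λ (z , z∈ , r′) → blockOf⁺ P w (z , proj₂ (h z) (z , z∈ , Admissible.sameVertex A w₁∈ z∈ z∈) , g r′))

  Represents-contractΦ : ∀ S → Represents (Linked S) (λ e → ¬ lbl e ∈ labels S) (contract Φ S)
  Represents-contractΦ S = record
    { vertices = P⇔
    ; image    = λ f∈ → let e , e∈ , e∉ , eq = ∈-contract⁻ Φ S f∈ in
                        e , e∈ , e∉ , subst (Image (Linked S) e) (≡.sym eq) (image e∈)
    ; preimage = λ e∈ e∉ → _ , ∈-contract⁺ Φ S e∈ e∉ , image e∈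
    }
    where
    P = blocks (V Φ) S
    P⇔ : SameBlock P ⇔₂ Linked S
    P⇔ = SameBlock-Linked S
    image : ∀ {e} → e ∈ E Φ → Image (Linked S) e (contractEdge P e)
    image e∈ = refl , refl ,
      saturation (srcV e∈) , saturation (tgtV e∈)
      where
      saturation : ∀ {w} → w ∈ V Φ → Saturation (Linked S) w (blockOf P w)
      saturation w∈ = blockOf-saturation Admissible-SameBlock (Admissible-Linked S) P⇔
                        (Admissible.coarse (Admissible-Linked S)) w∈ (Saturation-self w∈)

  join-image : ∀ {R e f} → Admissible R → e ∈ E Φ → Image R e f → join R f ⇔₂ join R e
  join-image {R} {e} {f} A e∈ (_ , _ , s , t) = glue-along {R} to , glue-along {R} from
    where
    to : ∀ {x} → Near R (ends f) x → Near R (ends e) x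
    to n with Near-++⁻ {R} (src f) n
    ... | inj₁ ns = Near-++⁺ {R} (src e) (inj₁ (proj₁ (Near-saturation A (srcV e∈) s) ns))
    ... | inj₂ nt = Near-++⁺ {R} (src e) (inj₂ (proj₁ (Near-saturation A (tgtV e∈) t) nt))
    from : ∀ {x} → Near R (ends e) x → Near R (ends f) x
    from n with Near-++⁻ {R} (src e) n
    ... | inj₁ ns = Near-++⁺ {R} (src f) (inj₁ (proj₂ (Near-saturation A (srcV e∈) s) ns))
    ... | inj₂ nt = Near-++⁺ {R} (src f) (inj₂ (proj₂ (Near-saturation A (tgtV e∈) t) nt))

  Represents-contract : ∀ {R K X f e} → Admissible R → Represents R K X → f ∈ E X → e ∈ E Φ → Image R e f →
                        Represents (join R e) (λ e′ → K e′ × ¬ lbl e′ ∈ labels (f ∷ [])) (contract X (f ∷ []))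
  Represents-contract {R} {K} {X} {f} {e} A rX f∈ e∈ im = record
    { vertices = P⇔
    ; image    = λ f′∈ → let f₀ , f₀∈ , f₀∉ , eq = ∈-contract⁻ X (f ∷ []) f′∈
                             e′ , e′∈ , k , im′@(l , _) = image f₀∈
                         in e′ , e′∈ , (k , subst (λ n → ¬ n ∈ labels (f ∷ [])) l f₀∉) ,
                            subst (Image (join R e) e′) (≡.sym eq) (contractImage e′∈ im′)
    ; preimage = λ e′∈ (k , e′∉) → let f₀ , f₀∈ , im′@(l , _) = preimage e′∈ k in
                   _ , ∈-contract⁺ X (f ∷ []) f₀∈ (subst (λ n → ¬ n ∈ labels (f ∷ [])) (≡.sym l) e′∉) ,
                   contractImage e′∈ im′
    }
    where
    open Represents rX
    P = blocks (V X) (f ∷ [])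
    P⇔ : SameBlock P ⇔₂ join R e
    P⇔ = ⇔₂-trans (SameBlock-blocks (f ∷ []) (V X) vertices) (join-image A e∈ im)
    contractImage : ∀ {e′ f₀} → e′ ∈ E Φ → Image R e′ f₀ → Image (join R e) e′ (contractEdge P f₀)
    contractImage e′∈ (l , g , s , t) =
      l , g , blockOf-saturation A (Admissible-join e A) P⇔ inj₁ (srcV e′∈) s
            , blockOf-saturation A (Admissible-join e A) P⇔ inj₁ (tgtV e′∈) t

  Loop : AtomRel → Edge → Set
  Loop R e = ∃[ z ] z ∈ src e × Near R (tgt e) z

  Loop? : ∀ {R} → (∀ a b → Dec (R a b)) → ∀ e → Dec (Loop R e)
  Loop? R? e = Dec.map′ find (λ (z , z∈ , n) → lose z∈ n) (Any.any? (Near? R? (tgt e)) (src e))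

  Loop⇒IsLoop : ∀ {R e f} → Admissible R → e ∈ E Φ → Image R e f → Loop R e → IsLoop f
  Loop⇒IsLoop A e∈ (_ , _ , s , t) (z , z∈ , z′ , z′∈ , r) a =
    (λ a∈ → let y , y∈ , r′ = proj₁ (s a) a∈ in
            proj₂ (t a) (z′ , z′∈ , trans r′ (trans (sameVertex (srcV e∈) y∈ z∈) r))) ,
    (λ a∈ → let y , y∈ , r′ = proj₁ (t a) a∈ in
            proj₂ (s a) (z , z∈ , trans r′ (trans (sameVertex (tgtV e∈) y∈ z′∈) (sym r))))
    where open Admissible A

  IsLoop⇒Loop : ∀ {R e f} → Admissible R → e ∈ E Φ → Image R e f → IsLoop f → Loop R e
  IsLoop⇒Loop A e∈ (_ , _ , s , t) f-loop
    with z , z∈ ← nonempty-atom (All.lookup (WF.nonempty wfΦ) (srcV e∈)) =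
    z , z∈ , proj₁ (t z) (proj₁ (f-loop z) (proj₂ (s z) (z , z∈ , Admissible.sameVertex A (srcV e∈) z∈ z∈)))

  Joins : AtomRel → Edge → Set
  Joins R e = ∀ {z z′} → z ∈ src e → z′ ∈ tgt e → R z z′

  Loop⇒Joins : ∀ {R e} → Admissible R → e ∈ E Φ → Loop R e → Joins R e
  Loop⇒Joins A e∈ (z , z∈ , z′ , z′∈ , r) y∈ y′∈ =
    trans (sameVertex (srcV e∈) y∈ z∈) (trans r (sameVertex (tgtV e∈) z′∈ y′∈))
    where open Admissible A

  join-absorb : ∀ {R e} → Admissible R → e ∈ E Φ → Joins R e → join R e ⇒ R
  join-absorb {R} {e} A e∈ joins = absorb
    where
    open Admissible A
    ends-related : ∀ {z₁ z₂} → z₁ ∈ ends e → z₂ ∈ ends e → R z₁ z₂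
    ends-related m₁ m₂ with ∈-++⁻ (src e) m₁ | ∈-++⁻ (src e) m₂
    ... | inj₁ p | inj₁ q = sameVertex (srcV e∈) p q
    ... | inj₁ p | inj₂ q = joins p q
    ... | inj₂ p | inj₁ q = sym (joins q p)
    ... | inj₂ p | inj₂ q = sameVertex (tgtV e∈) p q
    absorb : join R e ⇒ R
    absorb (inj₁ r) = r
    absorb (inj₂ ((z₁ , m₁ , r₁) , (z₂ , m₂ , r₂))) = trans r₁ (trans (ends-related m₁ m₂) (sym r₂))

  join-loop : ∀ {R e} → Admissible R → e ∈ E Φ → Loop R e → join R e ⇔₂ R
  join-loop A e∈ loop = join-absorb A e∈ (Loop⇒Joins A e∈ loop) , inj₁

  Represents-dec : ∀ {R K X} → Represents R K X → ∀ a b → Dec (R a b)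
  Represents-dec {X = X} rX a b =
    Dec.map′ (proj₁ (Represents.vertices rX)) (proj₂ (Represents.vertices rX)) (SameBlock? (V X) a b)

module Expansion {c ℓ} (G : Group c ℓ) (Φ : GainGraphs.GG G) (wfΦ : GainGraphs.WF G Φ) where
  open Group G using (_≈_; ε)
  open GainGraphs G
  open Blocks G
  open Minors G Φ wfΦ
  open Chromatic G
  open SetoidReasoning (AbelianGroup.setoid chromaticGroup)

  delete-contract : ∀ {R K X f e} → WF X → Admissible R → Represents R K X → f ∈ E X → e ∈ E Φ → Image R e f →
                    Neutral e → [ X ] ∼ [ delete (lbl f ∷ []) X ] ⊕ ⊝ [ contract X (f ∷ []) ]
  delete-contract {R} {K} {X} {f} {e} wX A rX f∈ e∈ im@(_ , gain≡ , _) e-neutral =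
    by-cases (Loop? (Represents-dec rX) e)
    where
    f-neutral : Neutral f
    f-neutral = subst (_≈ ε) (≡.sym gain≡) e-neutral
    deletion≈contraction : Loop R e → [ delete (lbl f ∷ []) X ] ∼ [ contract X (f ∷ []) ]
    deletion≈contraction loop =
      gen-≅ (WF-delete X (lbl f ∷ []) wX) (WF-contract X (f ∷ []) wX λ { (here refl) → f∈ })
        (Represents-≅ (WF-delete X (lbl f ∷ []) wX) (WF-contract X (f ∷ []) wX λ { (here refl) → f∈ })
          (Represents-delete (lbl f ∷ []) rX)
          (Represents-resp (join-loop A e∈ loop) (λ _ → ⇔-id _) (Represents-contract A rX f∈ e∈ im)))
    by-cases : Dec (Loop R e) → [ X ] ∼ [ delete (lbl f ∷ []) X ] ⊕ ⊝ [ contract X (f ∷ []) ]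
    by-cases (no ¬loop) = del-con X f wX f∈ f-neutral (¬loop ∘ IsLoop⇒Loop A e∈ im)
    by-cases (yes loop) = ∼-trans (nloop X f wX f∈ f-neutral (Loop⇒IsLoop A e∈ im loop))
                                  (∼-sym (∼-trans (∙-congʳ (deletion≈contraction loop)) (inverseʳ _)))

  Survives : List Edge → List Edge → Edge → Set
  Survives S D e = ¬ lbl e ∈ labels S × ¬ lbl e ∈ labels D

  minor : List Edge → List Edge → GG
  minor S D = delete (labels D) (contract Φ S)

  WF-minor : ∀ S D → (∀ {e} → e ∈ S → e ∈ E Φ) → WF (minor S D)
  WF-minor S D S⊆ = WF-delete _ (labels D) (WF-contract Φ S wfΦ S⊆)

  Represents-minor : ∀ S D → Represents (Linked S) (Survives S D) (minor S D)
  Represents-minor S D = Represents-delete (labels D) (Represents-contractΦ S)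

  signedTerm : List Edge → List Edge → List Edge × List Edge → Expr
  signedTerm S₀ D₀ (S , C) = sign S · [ minor (S₀ ++ S) (D₀ ++ C) ]

  signedExpansion : List Edge → List Edge → List Edge → Expr
  signedExpansion S₀ D₀ L = Σᴱ (map (signedTerm S₀ D₀) (splits L))

  signedExpansion-∷ : ∀ S₀ D₀ e L → signedExpansion S₀ D₀ (e ∷ L) ∼
                      signedExpansion S₀ (D₀ ++ e ∷ []) L ⊕ ⊝ signedExpansion (S₀ ++ e ∷ []) D₀ L
  signedExpansion-∷ S₀ D₀ e L = begin
    Σᴱ (map (signedTerm S₀ D₀) (splits (e ∷ L)))
      ≈⟨ sum-splits-∷ (signedTerm S₀ D₀) e L ⟩
    Σᴱ (map (signedTerm S₀ D₀ ∘ put₁ e) sp) ⊕ Σᴱ (map (signedTerm S₀ D₀ ∘ put₂ e) sp)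
      ≈⟨ ⊕-comm _ _ ⟩
    Σᴱ (map (signedTerm S₀ D₀ ∘ put₂ e) sp) ⊕ Σᴱ (map (signedTerm S₀ D₀ ∘ put₁ e) sp)
      ≈⟨ ⊕-cong (sum-cong sp deleted) (∼-trans (sum-cong sp contracted) (sum-⁻¹ (signedTerm (S₀ ++ e ∷ []) D₀) sp)) ⟩
    signedExpansion S₀ (D₀ ++ e ∷ []) L ⊕ ⊝ signedExpansion (S₀ ++ e ∷ []) D₀ L ∎
    where
    sp = splits L
    deleted : ∀ {q} → q ∈ sp → signedTerm S₀ D₀ (put₂ e q) ∼ signedTerm S₀ (D₀ ++ e ∷ []) q
    deleted {S , C} _ = ≡⇒∼ (cong (λ D → sign S · [ minor (S₀ ++ S) D ]) (≡.sym (++-assoc D₀ (e ∷ []) C)))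
    contracted : ∀ {q} → q ∈ sp → signedTerm S₀ D₀ (put₁ e q) ∼ ⊝ signedTerm (S₀ ++ e ∷ []) D₀ q
    contracted {S , C} _ = ∼-sym (∼-trans (⊝-· (sign S) [ minor ((S₀ ++ e ∷ []) ++ S) (D₀ ++ C) ])
      (≡⇒∼ (cong₂ (λ z S′ → z · [ minor S′ (D₀ ++ C) ]) (≡.sym (sign-∷ e S)) (++-assoc S₀ (e ∷ []) S))))

  ∉-snoc : ∀ {n} D e → (¬ n ∈ labels D × ¬ n ∈ (lbl e ∷ [])) ⇔ (¬ n ∈ labels (D ++ e ∷ []))
  ∉-snoc {n} D e rewrite map-++ lbl D (e ∷ []) =
    mk⇔ (λ (n∉D , n∉e) n∈ → [ n∉D , n∉e ]′ (∈-++⁻ (labels D) n∈))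
        (λ n∉ → n∉ ∘ ∈-++⁺ˡ , n∉ ∘ ∈-++⁺ʳ (labels D))

  Survives-deleted : ∀ S D e {n} → n ≡ lbl e → ∀ {e′} →
                     (Survives S D e′ × ¬ lbl e′ ∈ (n ∷ [])) ⇔ Survives S (D ++ e ∷ []) e′
  Survives-deleted S D e refl =
    mk⇔ (λ ((∉S , ∉D) , ∉e) → ∉S , Equivalence.to (∉-snoc D e) (∉D , ∉e))
        (λ (∉S , ∉De) → let ∉D , ∉e = Equivalence.from (∉-snoc D e) ∉De in (∉S , ∉D) , ∉e)

  Survives-contracted : ∀ S D e {n} → n ≡ lbl e → ∀ {e′} →
                        (Survives S D e′ × ¬ lbl e′ ∈ (n ∷ [])) ⇔ Survives (S ++ e ∷ []) D e′
  Survives-contracted S D e refl =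
    mk⇔ (λ ((∉S , ∉D) , ∉e) → Equivalence.to (∉-snoc S e) (∉S , ∉e) , ∉D)
        (λ (∉Se , ∉D) → let ∉S , ∉e = Equivalence.from (∉-snoc S e) ∉Se in (∉S , ∉D) , ∉e)

  expansion : ∀ L S₀ D₀ {X} → WF X → Represents (Linked S₀) (Survives S₀ D₀) X → (∀ {e} → e ∈ S₀ → e ∈ E Φ) →
              (∀ {e} → e ∈ L → e ∈ E Φ × Neutral e × Survives S₀ D₀ e) → Unique (labels L) →
              [ X ] ∼ signedExpansion S₀ D₀ L
  expansion [] S₀ D₀ {X} wX rX S₀⊆ _ _ = begin
    [ X ]
      ≈⟨ gen-≅ wX (WF-minor S₀ D₀ S₀⊆) (Represents-≅ wX (WF-minor S₀ D₀ S₀⊆) rX (Represents-minor S₀ D₀)) ⟩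
    [ minor S₀ D₀ ]
      ≡⟨ cong₂ (λ S D → [ minor S D ]) (++-identityʳ S₀) (++-identityʳ D₀) ⟨
    [ minor (S₀ ++ []) (D₀ ++ []) ]
      ≈⟨ ∼-trans (identityʳ _) (identityʳ _) ⟨
    signedExpansion S₀ D₀ [] ∎
  expansion (e ∷ L) S₀ D₀ {X} wX rX S₀⊆ L⊆ (e∉L ∷ uL)
    with e∈ , e-neutral , e-survives ← L⊆ (here refl)
    with f , f∈ , im@(lf , _) ← Represents.preimage rX e∈ e-survives = begin
    [ X ]
      ≈⟨ delete-contract wX (Admissible-Linked S₀) rX f∈ e∈ im e-neutral ⟩
    [ delete (lbl f ∷ []) X ] ⊕ ⊝ [ contract X (f ∷ []) ]
      ≈⟨ ⊕-cong deleted (⊝-cong contracted) ⟩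
    signedExpansion S₀ (D₀ ++ e ∷ []) L ⊕ ⊝ signedExpansion (S₀ ++ e ∷ []) D₀ L
      ≈⟨ signedExpansion-∷ S₀ D₀ e L ⟨
    signedExpansion S₀ D₀ (e ∷ L) ∎
    where
    e≢ : ∀ {e′} → e′ ∈ L → ¬ lbl e′ ∈ (lbl e ∷ [])
    e≢ e′∈ (here eq) = All.lookup e∉L (∈-map⁺ lbl e′∈) (≡.sym eq)
    deleted : [ delete (lbl f ∷ []) X ] ∼ signedExpansion S₀ (D₀ ++ e ∷ []) L
    deleted = expansion L S₀ (D₀ ++ e ∷ []) (WF-delete X (lbl f ∷ []) wX)
      (Represents-resp ((λ r → r) , (λ r → r)) (λ {e′} _ → Survives-deleted S₀ D₀ e lf {e′}) (Represents-delete (lbl f ∷ []) rX)) S₀⊆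
      (λ e′∈ → let e′∈Φ , n , n∉S , n∉D = L⊆ (there e′∈) in
               e′∈Φ , n , n∉S , Equivalence.to (∉-snoc D₀ e) (n∉D , e≢ e′∈))
      uL
    contracted : [ contract X (f ∷ []) ] ∼ signedExpansion (S₀ ++ e ∷ []) D₀ L
    contracted = expansion L (S₀ ++ e ∷ []) D₀ (WF-contract X (f ∷ []) wX λ { (here refl) → f∈ })
      (Represents-resp (Linked-snoc S₀ e) (λ {e′} _ → Survives-contracted S₀ D₀ e lf {e′})
        (Represents-contract (Admissible-Linked S₀) rX f∈ e∈ im))
      (λ e′∈ → [ S₀⊆ , (λ { (here refl) → e∈ }) ]′ (∈-++⁻ S₀ e′∈))
      (λ e′∈ → let e′∈Φ , n , n∉S , n∉D = L⊆ (there e′∈) in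
               e′∈Φ , n , Equivalence.to (∉-snoc S₀ e) (n∉S , e≢ e′∈) , n∉D)
      uL

  Φ-expansion : ∀ E₀ → E₀ ⊆ E Φ → All Neutral E₀ → [ Φ ] ∼ signedSum Φ E₀
  Φ-expansion E₀ E₀⊆ E₀-neutral = ∼-trans
    (expansion E₀ [] [] wfΦ (Represents-resp ((λ r → r) , (λ r → r)) (λ _ → mk⇔ (λ _ → (λ ()) , (λ ())) (λ _ → tt)) Represents-Φ)
               (λ ()) (λ e∈ → ∈-⊆ E₀⊆ e∈ , All.lookup E₀-neutral e∈ , (λ ()) , (λ ()))
               (Unique-map-⊆ lbl E₀⊆ (WF.uniqueL wfΦ)))
    (sum-cong (splits E₀) (λ _ → ∼-refl))

module Closure {c ℓ} (G : Group c ℓ) (Φ : GainGraphs.GG G) (wfΦ : GainGraphs.WF G Φ)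
               (E₀ : List (GainGraphs.Edge G)) (E₀⊆ : E₀ ⊆ GainGraphs.E {G = G} Φ) where
  open GainGraphs G
  open Blocks G
  open Minors G Φ wfΦ

  uE₀ : Unique (labels E₀)
  uE₀ = Unique-map-⊆ lbl E₀⊆ (WF.uniqueL wfΦ)

  foldl-join-inflationary : ∀ S {R} → R ⇒ foldl join R S
  foldl-join-inflationary []      r = r
  foldl-join-inflationary (e ∷ S) r = foldl-join-inflationary S (inj₁ r)

  foldl-join-least : ∀ S {R₀ R} → Admissible R → R₀ ⇒ R → (∀ {e} → e ∈ S → e ∈ E Φ × Joins R e) →
                     foldl join R₀ S ⇒ R
  foldl-join-least []      A R₀⇒R hS = R₀⇒R
  foldl-join-least (e ∷ S) {R₀} {R} A R₀⇒R hS =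
    foldl-join-least S A (λ r → join-absorb A e∈ joins (glue-mono {R₀} {R} R₀⇒R r)) (hS ∘ there)
    where
    e∈ = proj₁ (hS (here refl))
    joins = proj₂ (hS (here refl))

  foldl-join-joins : ∀ S {R} → Admissible R → S ⊆ₘ E Φ → ∀ {e} → e ∈ S → Joins (foldl join R S) e
  foldl-join-joins (e ∷ S) A S⊆ (here refl) z∈ z′∈ =
    foldl-join-inflationary S (inj₂ ((_ , ∈-++⁺ˡ z∈ , sameVertex (srcV e∈) z∈ z∈) ,
                                     (_ , ∈-++⁺ʳ (src e) z′∈ , sameVertex (tgtV e∈) z′∈ z′∈)))
    where
    open Admissible A
    e∈ = S⊆ (here refl)
  foldl-join-joins (e ∷ S) A S⊆ (there e′∈) = foldl-join-joins S (Admissible-join e A) (S⊆ ∘ there) e′∈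

  Linked-mono : ∀ {S T} → S ⊆ₘ T → T ⊆ₘ E Φ → Linked S ⇒ Linked T
  Linked-mono {S} {T} S⊆T T⊆ = foldl-join-least S (Admissible-Linked T) (Admissible.coarse (Admissible-Linked T))
    (λ e∈ → T⊆ (S⊆T e∈) , foldl-join-joins T Admissible-SameBlock T⊆ (S⊆T e∈))

  joinedᵇ⁻ : ∀ S {e} → e ∈ E Φ → T (joinedᵇ Φ E₀ S e) → Joins (Linked S) e
  joinedᵇ⁻ S {e} e∈ h z∈ z′∈ with y , y∈ , y∈blk ← meets⁻ _ (tgt e) h
                             with w , w∈ , same ← blockOf⁻ (blocks (V Φ) S) (src e) y∈blk =
    trans (sameVertex (srcV e∈) z∈ w∈) (trans (sym (proj₁ (SameBlock-Linked S) same)) (sameVertex (tgtV e∈) y∈ z′∈))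
    where open Admissible (Admissible-Linked S)

  joinedᵇ⁺ : ∀ S {e} → e ∈ E Φ → Joins (Linked S) e → T (joinedᵇ Φ E₀ S e)
  joinedᵇ⁺ S {e} e∈ joins with z , z∈ ← nonempty-atom (All.lookup (WF.nonempty wfΦ) (srcV e∈))
                          with z′ , z′∈ ← nonempty-atom (All.lookup (WF.nonempty wfΦ) (tgtV e∈)) =
    meets⁺ z′∈ (blockOf⁺ (blocks (V Φ) S) (src e)
      (z , z∈ , proj₂ (SameBlock-Linked S) (Admissible.sym (Admissible-Linked S) (joins z∈ z′∈))))

  closedᵇ⁻ : ∀ {S} → T (closedᵇ Φ E₀ S) → ∀ {e} → e ∈ E₀ → T (joinedᵇ Φ E₀ S e) → lbl e ∈ labels S
  closedᵇ⁻ {S} closed {e} e∈ joined =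
    ∈ᵇ⁻ (labels S) (modus-ponens (all⁻ (λ e → not (joinedᵇ Φ E₀ S e) ∨ (lbl e ∈ᵇ labels S)) closed e∈) joined)
    where
    modus-ponens : ∀ {j l} → T (not j ∨ l) → T j → T l
    modus-ponens {true} l _ = l

  closure : List Edge → List Edge
  closure S = filterᵇ (joinedᵇ Φ E₀ S) E₀

  E₀⊆Φ : E₀ ⊆ₘ E Φ
  E₀⊆Φ = ∈-⊆ E₀⊆

  ⊆-closure : ∀ {S} → S ⊆ₘ E₀ → S ⊆ₘ closure S
  ⊆-closure {S} S⊆ e∈ =
    ∈-filter⁺ (T? ∘ joinedᵇ Φ E₀ S) (S⊆ e∈) (joinedᵇ⁺ S (E₀⊆Φ (S⊆ e∈)) (foldl-join-joins S Admissible-SameBlock (E₀⊆Φ ∘ S⊆) e∈))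

  closure-⊆ : ∀ S → closure S ⊆ E₀
  closure-⊆ S = filter-⊆ (T? ∘ joinedᵇ Φ E₀ S) E₀

  Linked-closure : ∀ {S} → S ⊆ₘ E₀ → Linked (closure S) ⇔₂ Linked S
  Linked-closure {S} S⊆ =
    foldl-join-least (closure S) (Admissible-Linked S) (Admissible.coarse (Admissible-Linked S))
      (λ e∈ → let e∈E₀ , joined = ∈-filter⁻ (T? ∘ joinedᵇ Φ E₀ S) e∈ in E₀⊆Φ e∈E₀ , joinedᵇ⁻ S (E₀⊆Φ e∈E₀) joined) ,
    Linked-mono (⊆-closure S⊆) (E₀⊆Φ ∘ ∈-⊆ (closure-⊆ S))

  closure-closed : ∀ {S} → S ⊆ₘ E₀ → T (closedᵇ Φ E₀ (closure S))
  closure-closed {S} S⊆ = all⁺ _ E₀ closed-at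
    where
    closed-at : ∀ {e} → e ∈ E₀ → T (not (joinedᵇ Φ E₀ (closure S) e) ∨ (lbl e ∈ᵇ labels (closure S)))
    closed-at {e} e∈ with joinedᵇ Φ E₀ (closure S) e in joined
    ... | false = _
    ... | true  = Equivalence.from T-∨ (inj₂ (∈ᵇ⁺ (∈-map⁺ lbl (∈-filter⁺ (T? ∘ joinedᵇ Φ E₀ S) e∈
                    (joinedᵇ⁺ S (E₀⊆Φ e∈) λ z∈ z′∈ →
                      proj₁ (Linked-closure S⊆) (joinedᵇ⁻ (closure S) (E₀⊆Φ e∈) (≡.subst T (≡.sym joined) _) z∈ z′∈))))))

  closure-least : ∀ {S U} → U ⊆ₘ E₀ → T (closedᵇ Φ E₀ U) → S ⊆ₘ U → closure S ⊆ₘ U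
  closure-least {S} {U} U⊆ closed S⊆U e∈ with e∈E₀ , joined ← ∈-filter⁻ (T? ∘ joinedᵇ Φ E₀ S) e∈ =
    Unique-∈-map⁻ lbl uE₀ U⊆ e∈E₀ (closedᵇ⁻ closed e∈E₀ (joinedᵇ⁺ U (E₀⊆Φ e∈E₀) λ z∈ z′∈ →
      Linked-mono S⊆U (E₀⊆Φ ∘ U⊆) (joinedᵇ⁻ S (E₀⊆Φ e∈E₀) joined z∈ z′∈)))

module Coefficients {c ℓ} (G : Group c ℓ) (Φ : GainGraphs.GG G) (wfΦ : GainGraphs.WF G Φ)
                    (E₀ : List (GainGraphs.Edge G)) (E₀⊆ : E₀ ⊆ GainGraphs.E {G = G} Φ) where
  open GainGraphs G
  open Closure G Φ wfΦ E₀ E₀⊆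
  open ListSumᴳ ℤ.+-0-abelianGroup using (sum-cong; sum-zero; sum-swap; sum-splits-∷; select; sum-select-one; sum-select-none)
  open SignSums
  open ≡.≡-Reasoning

  Closed : List Edge → Set
  Closed S = T (closedᵇ Φ E₀ S)

  -- Σ over S ⊆ E₀ with cl S = U of (-1)^|S|, subsets being compared through their labels
  fibreSign : List Edge → ℤ
  fibreSign U = sumℤ (map (λ p → if does (labels U ≟ₗ labels (closure (proj₁ p))) then sign (proj₁ p) else + 0) (splits E₀))

  labels-injective : ∀ {S U} → S ⊆ E₀ → U ⊆ E₀ → labels S ≡ labels U → S ≡ U
  labels-injective {S} {U} S⊆ U⊆ eq = sublist-≡ (Unique.map⁻ uE₀) S⊆ U⊆
    (λ e∈ → Unique-∈-map⁻ lbl uE₀ (∈-⊆ U⊆) (∈-⊆ S⊆ e∈) (subst (_ ∈_) eq (∈-map⁺ lbl e∈)))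
    (λ e∈ → Unique-∈-map⁻ lbl uE₀ (∈-⊆ S⊆) (∈-⊆ U⊆ e∈) (subst (_ ∈_) (≡.sym eq) (∈-map⁺ lbl e∈)))

  fibre-closed : ∀ {U S} → U ⊆ E₀ → S ⊆ E₀ → labels U ≡ labels (closure S) → Closed U
  fibre-closed {U} {S} U⊆ S⊆ eq = subst Closed (≡.sym (labels-injective U⊆ (closure-⊆ S) eq)) (closure-closed (∈-⊆ S⊆))

  _⊆ᵇ_ : List Edge → List Edge → Bool
  S ⊆ᵇ U = all (λ e → lbl e ∈ᵇ labels U) S

  ⊆ᵇ⁻ : ∀ {S U} → S ⊆ₘ E₀ → U ⊆ₘ E₀ → T (S ⊆ᵇ U) → S ⊆ₘ U
  ⊆ᵇ⁻ {S} {U} S⊆ U⊆ h e∈ = Unique-∈-map⁻ lbl uE₀ U⊆ (S⊆ e∈) (∈ᵇ⁻ (labels U) (all⁻ _ h e∈))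

  ⊆ᵇ⁺ : ∀ {S U} → S ⊆ₘ U → T (S ⊆ᵇ U)
  ⊆ᵇ⁺ {S} S⊆U = all⁺ _ S (λ e∈ → ∈ᵇ⁺ (∈-map⁺ lbl (S⊆U e∈)))

  ⊆ᵇ-∷ : ∀ S x U → (∀ {e} → e ∈ S → ¬ lbl e ≡ lbl x) → (S ⊆ᵇ (x ∷ U)) ≡ (S ⊆ᵇ U)
  ⊆ᵇ-∷ []      x U h = refl
  ⊆ᵇ-∷ (e ∷ S) x U h with lbl e ≡ᵇ lbl x in eq
  ... | true  = ⊥-elim (h (here refl) (ℕ.≡ᵇ⇒≡ (lbl e) (lbl x) (subst T (≡.sym eq) _)))
  ... | false = cong ((lbl e ∈ᵇ labels U) ∧_) (⊆ᵇ-∷ S x U (h ∘ there))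

  closureTerm : List Edge → List Edge × List Edge → ℤ
  closureTerm S q =
    if closedᵇ Φ E₀ (proj₁ q) then (if does (labels (proj₁ q) ≟ₗ labels (closure S)) then sign S else + 0) else + 0

  closureTerm-closed : ∀ {S U q} → S ⊆ E₀ → U ⊆ E₀ → q ∈ splits U →
                       closureTerm S q ≡ (if does (labels (proj₁ q) ≟ₗ labels (closure S)) then sign S else + 0)
  closureTerm-closed {S} {U} {q} S⊆ U⊆ q∈ with labels (proj₁ q) ≟ₗ labels (closure S)
  ... | no _ with closedᵇ Φ E₀ (proj₁ q)
  ...   | true  = refl
  ...   | false = refl
  closureTerm-closed {S} {U} {q} S⊆ U⊆ q∈ | yes eq
    with closedᵇ Φ E₀ (proj₁ q) | fibre-closed (⊆-trans (splits-⊆₁ U q∈) U⊆) S⊆ eq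
  ... | true | _ = refl

  -- for closed U, the closures inside U are the closures of the subsets of U
  closure-count : ∀ {S U} → S ⊆ E₀ → U ⊆ E₀ → Closed U →
                  sumℤ (map (closureTerm S) (splits U)) ≡ (if S ⊆ᵇ U then sign S else + 0)
  closure-count {S} {U} S⊆ U⊆ U-closed with S ⊆ᵇ U in S⊆ᵇU
  ... | true = begin
    sumℤ (map (closureTerm S) (splits U))
      ≡⟨ sum-cong (splits U) (closureTerm-closed S⊆ U⊆) ⟩
    sumℤ (map (select key (labels W) (λ _ → sign S)) (splits U))
      ≡⟨ cong (λ k → sumℤ (map (select key k (λ _ → sign S)) (splits U))) (cong labels q₀≡W) ⟨
    sumℤ (map (select key (key q₀) (λ _ → sign S)) (splits U))
      ≡⟨ sum-select-one key (λ _ → sign S) (splits U) (Unique-splits lbl U (Unique-map-⊆ lbl U⊆ uE₀)) q₀∈ ⟩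
    sign S ∎
    where
    W = closure S
    key = labels ∘ proj₁
    W⊆U : W ⊆ₘ U
    W⊆U = closure-least (∈-⊆ U⊆) U-closed (⊆ᵇ⁻ (∈-⊆ S⊆) (∈-⊆ U⊆) (subst T (≡.sym S⊆ᵇU) _))
    inW : Edge → Bool
    inW e = lbl e ∈ᵇ labels W
    q₀ = filterᵇ inW U , filterᵇ (not ∘ inW) U
    q₀∈ : q₀ ∈ splits U
    q₀∈ = filter-∈-splits inW U
    q₀≡W : proj₁ q₀ ≡ W
    q₀≡W = sublist-≡ (Unique.map⁻ uE₀) (⊆-trans (filter-⊆ (T? ∘ inW) U) U⊆) (closure-⊆ S)
      (λ e∈ → let e∈U , e-in = ∈-filter⁻ (T? ∘ inW) e∈ in
              Unique-∈-map⁻ lbl uE₀ (∈-⊆ (closure-⊆ S)) (∈-⊆ U⊆ e∈U) (∈ᵇ⁻ (labels W) e-in))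
      (λ e∈ → ∈-filter⁺ (T? ∘ inW) (W⊆U e∈) (∈ᵇ⁺ (∈-map⁺ lbl e∈)))
  ... | false = ≡.trans (sum-cong (splits U) (closureTerm-closed S⊆ U⊆))
                        (sum-select-none (labels ∘ proj₁) (labels (closure S)) (λ _ → sign S) (splits U) outside)
    where
    outside : ∀ {q} → q ∈ splits U → ¬ labels (proj₁ q) ≡ labels (closure S)
    outside q∈ eq = subst T S⊆ᵇU (⊆ᵇ⁺ λ e∈ → ∈-⊆ (splits-⊆₁ U q∈)
      (subst (_ ∈_) (≡.sym (labels-injective (⊆-trans (splits-⊆₁ U q∈) U⊆) (closure-⊆ S) eq))
             (⊆-closure (∈-⊆ S⊆) e∈)))

  sum-⊆ᵇ : ∀ {xs U} → U ⊆ xs → Unique (labels xs) → (f : List Edge → ℤ) →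
           sumℤ (map (λ p → if proj₁ p ⊆ᵇ U then f (proj₁ p) else + 0) (splits xs)) ≡ sumℤ (map (f ∘ proj₁) (splits U))
  sum-⊆ᵇ [] _ f = refl
  sum-⊆ᵇ {x ∷ xs} {U} (.x ∷ʳ U⊆) (x∉ ∷ u) f = begin
    sumℤ (map g (splits (x ∷ xs)))
      ≡⟨ sum-splits-∷ g x xs ⟩
    sumℤ (map (g ∘ put₁ x) (splits xs)) +ℤ sumℤ (map (g ∘ put₂ x) (splits xs))
      ≡⟨ cong₂ _+ℤ_ (sum-zero (g ∘ put₁ x) (splits xs) (λ {q} _ → x-absent q)) (sum-⊆ᵇ U⊆ u f) ⟩
    + 0 +ℤ sumℤ (map (f ∘ proj₁) (splits U))
      ≡⟨ ℤ.+-identityˡ _ ⟩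
    sumℤ (map (f ∘ proj₁) (splits U)) ∎
    where
    g = λ p → if proj₁ p ⊆ᵇ U then f (proj₁ p) else + 0
    x-absent : ∀ q → g (put₁ x q) ≡ + 0
    x-absent q with lbl x ∈ᵇ labels U in x∈ᵇ
    ... | false = refl
    ... | true  = ⊥-elim (All.lookup x∉ (∈-⊆ (map⁺ lbl U⊆) (∈ᵇ⁻ (labels U) (subst T (≡.sym x∈ᵇ) _))) refl)
  sum-⊆ᵇ {x ∷ xs} {x ∷ U} (refl ∷ U⊆) (x∉ ∷ u) f = begin
    sumℤ (map g (splits (x ∷ xs)))
      ≡⟨ sum-splits-∷ g x xs ⟩
    sumℤ (map (g ∘ put₁ x) (splits xs)) +ℤ sumℤ (map (g ∘ put₂ x) (splits xs))
      ≡⟨ cong₂ _+ℤ_ (≡.trans (sum-cong (splits xs) with-x) (sum-⊆ᵇ U⊆ u (f ∘ (x ∷_))))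
                   (≡.trans (sum-cong (splits xs) without-x) (sum-⊆ᵇ U⊆ u f)) ⟩
    sumℤ (map (f ∘ (x ∷_) ∘ proj₁) (splits U)) +ℤ sumℤ (map (f ∘ proj₁) (splits U))
      ≡⟨ sum-splits-∷ (f ∘ proj₁) x U ⟨
    sumℤ (map (f ∘ proj₁) (splits (x ∷ U))) ∎
    where
    g = λ p → if proj₁ p ⊆ᵇ (x ∷ U) then f (proj₁ p) else + 0
    x-fresh : ∀ {q} → q ∈ splits xs → (proj₁ q ⊆ᵇ (x ∷ U)) ≡ (proj₁ q ⊆ᵇ U)
    x-fresh q∈ = ⊆ᵇ-∷ _ x U (λ e∈ eq → All.lookup x∉ (∈-⊆ (map⁺ lbl (splits-⊆₁ _ q∈)) (∈-map⁺ lbl e∈)) (≡.sym eq))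
    with-x : ∀ {q} → q ∈ splits xs → g (put₁ x q) ≡ (if proj₁ q ⊆ᵇ U then f (x ∷ proj₁ q) else + 0)
    with-x {q} q∈ with lbl x ∈ᵇ labels (x ∷ U) | ∈ᵇ⁺ {lbl x} {labels (x ∷ U)} (here refl)
    ... | true | _ rewrite x-fresh q∈ = refl
    without-x : ∀ {q} → q ∈ splits xs → g (put₂ x q) ≡ (if proj₁ q ⊆ᵇ U then f (proj₁ q) else + 0)
    without-x q∈ rewrite x-fresh q∈ = refl

  closed-fibreSign : List Edge × List Edge → ℤ
  closed-fibreSign q = if closedᵇ Φ E₀ (proj₁ q) then fibreSign (proj₁ q) else + 0

  -- each S ⊆ U is counted once, in the fibre of cl S ⊆ U
  sum-closed-fibreSign : ∀ {U} → U ⊆ E₀ → Closed U →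
                         sumℤ (map closed-fibreSign (splits U)) ≡ sumℤ (map (sign ∘ proj₁) (splits U))
  sum-closed-fibreSign {U} U⊆ U-closed = begin
    sumℤ (map closed-fibreSign (splits U))
      ≡⟨ sum-cong (splits U) (λ {q} _ → if-sum (closedᵇ Φ E₀ (proj₁ q)) _ (splits E₀)) ⟩
    sumℤ (map (λ q → sumℤ (map (λ p → closureTerm (proj₁ p) q) (splits E₀))) (splits U))
      ≡⟨ sum-swap (λ q p → closureTerm (proj₁ p) q) (splits U) (splits E₀) ⟩
    sumℤ (map (λ p → sumℤ (map (closureTerm (proj₁ p)) (splits U))) (splits E₀))
      ≡⟨ sum-cong (splits E₀) (λ p∈ → closure-count (splits-⊆₁ E₀ p∈) U⊆ U-closed) ⟩
    sumℤ (map (λ p → if proj₁ p ⊆ᵇ U then sign (proj₁ p) else + 0) (splits E₀))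
      ≡⟨ sum-⊆ᵇ U⊆ uE₀ sign ⟩
    sumℤ (map (sign ∘ proj₁) (splits U)) ∎

  properSubsets-≡ : ∀ S → properSubsets Φ E₀ S ≡ map proj₁ (properSplits S)
  properSubsets-≡ S = drop-first _ (λ _ _ _ → _) refl
    where
    drop-first : ∀ (keep : List Edge × List Edge → Bool) → (∀ s e C → T (keep (s , e ∷ C))) → keep (S , []) ≡ false →
                 map proj₁ (filterᵇ keep (splits S)) ≡ map proj₁ (properSplits S)
    drop-first keep keeps drops rewrite splits-proper S | drops =
      cong (map proj₁) (filter-all (T? ∘ keep) (All.tabulate λ q∈ → kept (properSplits-nonempty S q∈)))
      where
      kept : ∀ {q} → ¬ proj₂ q ≡ [] → T (keep q)
      kept {s , []}    ne = ⊥-elim (ne refl)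
      kept {s , e ∷ C} _  = keeps s e C

  -- the recursion defining the Möbius function μ₀(∅, ·)
  fibreSign-∷ : ∀ {x U} → (x ∷ U) ⊆ E₀ → Closed (x ∷ U) →
                fibreSign (x ∷ U) ≡ - sumℤ (map closed-fibreSign (properSplits (x ∷ U)))
  fibreSign-∷ {x} {U} U⊆ U-closed = inverseˡ-unique _ _ (begin
    fibreSign (x ∷ U) +ℤ sumℤ (map closed-fibreSign (properSplits (x ∷ U)))
      ≡⟨ cong (λ b → (if b then fibreSign (x ∷ U) else + 0) +ℤ sumℤ (map closed-fibreSign (properSplits (x ∷ U))))
              (Equivalence.to T-≡ U-closed) ⟨
    sumℤ (map closed-fibreSign ((x ∷ U , []) ∷ properSplits (x ∷ U)))
      ≡⟨ cong (sumℤ ∘ map closed-fibreSign) (splits-proper (x ∷ U)) ⟨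
    sumℤ (map closed-fibreSign (splits (x ∷ U)))
      ≡⟨ sum-closed-fibreSign U⊆ U-closed ⟩
    sumℤ (map (sign ∘ proj₁) (splits (x ∷ U)))
      ≡⟨ sum-sign-∷ x U ⟩
    + 0 ∎)
    where open import Algebra.Properties.Group (AbelianGroup.group ℤ.+-0-abelianGroup) using (inverseˡ-unique)

  fibreSign-[] : Closed [] → fibreSign [] ≡ + 1
  fibreSign-[] ∅-closed = begin
    fibreSign []
      ≡⟨ ℤ.+-identityʳ _ ⟨
    fibreSign [] +ℤ + 0
      ≡⟨ cong (λ b → (if b then fibreSign [] else + 0) +ℤ + 0) (Equivalence.to T-≡ ∅-closed) ⟨
    sumℤ (map closed-fibreSign (splits []))
      ≡⟨ sum-closed-fibreSign (minimum E₀) ∅-closed ⟩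
    + 1 ∎

  private
    shorter : ∀ (x : Edge) U {q n} → q ∈ properSplits (x ∷ U) → length U ≤ n → length (proj₁ q) ≤ n
    shorter x U q∈ |U|≤n = ℕ.≤-trans (s≤s⁻¹ (properSplits-shorter (x ∷ U) q∈)) |U|≤n

    properSplits-sublist : ∀ {U q} → U ⊆ E₀ → q ∈ properSplits U → proj₁ q ⊆ E₀
    properSplits-sublist {U} U⊆ q∈ = ⊆-trans (splits-⊆₁ U (properSplits-⊆ U q∈)) U⊆

  mu≡fibreSign : Closed [] → ∀ n {U} → U ⊆ E₀ → Closed U → length U ≤ n → mu Φ E₀ n U ≡ fibreSign U
  mu≡fibreSign ∅-closed n       {[]}    U⊆ _        _          = ≡.sym (fibreSign-[] ∅-closed)
  mu≡fibreSign ∅-closed (suc n) {x ∷ U} U⊆ U-closed (s≤s |U|≤n) = begin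
    - sumℤ (map (λ Q → if closedᵇ Φ E₀ Q then mu Φ E₀ n Q else + 0) (properSubsets Φ E₀ (x ∷ U)))
      ≡⟨ cong (λ Qs → - sumℤ (map (λ Q → if closedᵇ Φ E₀ Q then mu Φ E₀ n Q else + 0) Qs)) (properSubsets-≡ (x ∷ U)) ⟩
    - sumℤ (map (λ Q → if closedᵇ Φ E₀ Q then mu Φ E₀ n Q else + 0) (map proj₁ (properSplits (x ∷ U))))
      ≡⟨ cong (-_ ∘ sumℤ) (map-∘ (properSplits (x ∷ U))) ⟨
    - sumℤ (map (λ q → if closedᵇ Φ E₀ (proj₁ q) then mu Φ E₀ n (proj₁ q) else + 0) (properSplits (x ∷ U)))
      ≡⟨ cong -_ (sum-cong (properSplits (x ∷ U)) induction) ⟩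
    - sumℤ (map closed-fibreSign (properSplits (x ∷ U)))
      ≡⟨ fibreSign-∷ U⊆ U-closed ⟨
    fibreSign (x ∷ U) ∎
    where
    induction : ∀ {q} → q ∈ properSplits (x ∷ U) →
                (if closedᵇ Φ E₀ (proj₁ q) then mu Φ E₀ n (proj₁ q) else + 0) ≡ closed-fibreSign q
    induction {q} q∈ with closedᵇ Φ E₀ (proj₁ q) in q-closed
    ... | false = refl
    ... | true  = mu≡fibreSign ∅-closed n (properSplits-sublist U⊆ q∈) (subst T (≡.sym q-closed) _) (shorter x U q∈ |U|≤n)

  -- ∅ is not closed exactly when Γ₀ has a loop; then μ₀(∅, ·) = 0 by convention
  fibreSign-loop : ¬ Closed [] → ∀ n {U} → U ⊆ E₀ → Closed U → length U ≤ n → fibreSign U ≡ + 0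
  fibreSign-loop ∅-open n       {[]}    U⊆ ∅-closed _ = ⊥-elim (∅-open ∅-closed)
  fibreSign-loop ∅-open (suc n) {x ∷ U} U⊆ U-closed (s≤s |U|≤n) =
    ≡.trans (fibreSign-∷ U⊆ U-closed) (cong -_ (sum-zero closed-fibreSign (properSplits (x ∷ U)) induction))
    where
    induction : ∀ {q} → q ∈ properSplits (x ∷ U) → closed-fibreSign q ≡ + 0
    induction {q} q∈ with closedᵇ Φ E₀ (proj₁ q) in q-closed
    ... | false = refl
    ... | true  = fibreSign-loop ∅-open n (properSplits-sublist U⊆ q∈) (subst T (≡.sym q-closed) _) (shorter x U q∈ |U|≤n)

  fibreSign-open : ∀ {U} → U ⊆ E₀ → ¬ Closed U → fibreSign U ≡ + 0
  fibreSign-open {U} U⊆ U-open = sum-zero _ (splits E₀) outside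
    where
    outside : ∀ {p} → p ∈ splits E₀ →
              (if does (labels U ≟ₗ labels (closure (proj₁ p))) then sign (proj₁ p) else + 0) ≡ + 0
    outside {p} p∈ with labels U ≟ₗ labels (closure (proj₁ p))
    ... | yes eq = ⊥-elim (U-open (fibre-closed U⊆ (splits-⊆₁ E₀ p∈) eq))
    ... | no _   = refl

  fibreSign-μ₀ : ∀ {S} → S ⊆ E₀ → fibreSign S ≡ (if closedᵇ Φ E₀ S then μ₀ Φ E₀ S else + 0)
  fibreSign-μ₀ {S} S⊆ with closedᵇ Φ E₀ S in S-closed
  ... | false = fibreSign-open S⊆ (subst T S-closed)
  ... | true with closedᵇ Φ E₀ [] in ∅-closed
  ...   | true  = ≡.sym (mu≡fibreSign (subst T (≡.sym ∅-closed) _) (length S) S⊆ (subst T (≡.sym S-closed) _) ℕ.≤-refl)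
  ...   | false = fibreSign-loop (subst T ∅-closed) (length S) S⊆ (subst T (≡.sym S-closed) _) ℕ.≤-refl

module Regrouping {c ℓ} (G : Group c ℓ) (Φ : GainGraphs.GG G) (wfΦ : GainGraphs.WF G Φ)
                  (E₀ : List (GainGraphs.Edge G)) (E₀⊆ : E₀ ⊆ GainGraphs.E {G = G} Φ) where
  open GainGraphs G
  open Chromatic G
  open Minors G Φ wfΦ
  open Expansion G Φ wfΦ
  open Closure G Φ wfΦ E₀ E₀⊆
  open Coefficients G Φ wfΦ E₀ E₀⊆
  open SetoidReasoning (AbelianGroup.setoid chromaticGroup)

  minorOf : List Edge × List Edge → Expr
  minorOf (S , C) = [ minor S C ]

  closureSplit : List Edge × List Edge → List Edge × List Edge
  closureSplit (S , _) = closure S , filterᵇ (not ∘ joinedᵇ Φ E₀ S) E₀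

  closureSplit-∈ : ∀ p → closureSplit p ∈ splits E₀
  closureSplit-∈ (S , _) = filter-∈-splits (joinedᵇ Φ E₀ S) E₀

  Survives-split : ∀ {q} → q ∈ splits E₀ → ∀ e → Survives (proj₁ q) (proj₂ q) e ⇔ (¬ lbl e ∈ labels E₀)
  Survives-split q∈ e = mk⇔
    (λ (∉S , ∉C) l∈ → let e′ , e′∈ , l≡ = ∈-map⁻ lbl l∈ in
       [ ∉S ∘ subst (_∈ _) (≡.sym l≡) ∘ ∈-map⁺ lbl , ∉C ∘ subst (_∈ _) (≡.sym l≡) ∘ ∈-map⁺ lbl ]′ (splits-cover E₀ q∈ e′∈))
    (λ ∉E₀ → ∉E₀ ∘ ∈-⊆ (map⁺ lbl (splits-⊆₁ E₀ q∈)) , ∉E₀ ∘ ∈-⊆ (map⁺ lbl (splits-⊆₂ E₀ q∈)))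

  minor-closure : ∀ {p} → p ∈ splits E₀ → minorOf p ∼ minorOf (closureSplit p)
  minor-closure {S , C} p∈ = gen-≅ (WF-minor S C S⊆Φ) (WF-minor (closure S) C′ cl⊆Φ)
    (Represents-≅ (WF-minor S C S⊆Φ) (WF-minor (closure S) C′ cl⊆Φ)
      (Represents-minor S C)
      (Represents-resp (Linked-closure (∈-⊆ (splits-⊆₁ E₀ p∈)))
        (λ {e} _ → ⇔-sym (Survives-split p∈ e) ⇔-∘ Survives-split (closureSplit-∈ (S , C)) e)
        (Represents-minor (closure S) C′)))
    where
    C′ = proj₂ (closureSplit (S , C))
    S⊆Φ : ∀ {e} → e ∈ S → e ∈ E Φ
    S⊆Φ = E₀⊆Φ ∘ ∈-⊆ (splits-⊆₁ E₀ p∈)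
    cl⊆Φ : ∀ {e} → e ∈ closure S → e ∈ E Φ
    cl⊆Φ = E₀⊆Φ ∘ ∈-⊆ (closure-⊆ S)

  if-· : ∀ b (z : ℤ) x → (if b then z else + 0) · x ∼ (if b then z · x else 0#)
  if-· true  z x = ∼-refl
  if-· false z x = ∼-refl

  signedSum∼möbiusSum : signedSum Φ E₀ ∼ möbiusSum Φ E₀
  signedSum∼möbiusSum = begin
    signedSum Φ E₀
      ≈⟨ sum-cong (splits E₀) (λ {p} p∈ → ·-cong (sign (proj₁ p)) (minor-closure p∈)) ⟩
    Σᴱ (map (λ p → sign (proj₁ p) · minorOf (closureSplit p)) (splits E₀))
      ≈⟨ sum-fibres (labels ∘ proj₁) closureSplit (sign ∘ proj₁) minorOf (splits E₀) (splits E₀)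
                    (Unique-splits lbl E₀ uE₀) (λ {p} _ → closureSplit-∈ p) ⟩
    Σᴱ (map (λ q → fibreSign (proj₁ q) · minorOf q) (splits E₀))
      ≈⟨ sum-cong (splits E₀) (λ {q} q∈ → ≡⇒∼ (cong (_· minorOf q) (fibreSign-μ₀ (splits-⊆₁ E₀ q∈)))) ⟩
    Σᴱ (map (λ q → (if closedᵇ Φ E₀ (proj₁ q) then μ₀ Φ E₀ (proj₁ q) else + 0) · minorOf q) (splits E₀))
      ≈⟨ sum-cong (splits E₀) (λ {q} _ → if-· (closedᵇ Φ E₀ (proj₁ q)) _ _) ⟩
    möbiusSum Φ E₀ ∎

theorem4p2 : ∀ {c ℓ} (G : Group c ℓ) → let open GainGraphs G in
    (Φ : GG) (E₀ : List Edge) → WF Φ → NeutralPart Φ E₀ →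
    ([ Φ ] ∼ möbiusSum Φ E₀) × ([ Φ ] ∼ signedSum Φ E₀)
theorem4p2 G Φ E₀ wfΦ (E₀⊆ , E₀-neutral , _) = ∼-trans expanded regrouped , expanded
  where
  open GainGraphs G using (_∼_; ∼-trans; [_]; signedSum; möbiusSum)
  expanded : [ Φ ] ∼ signedSum Φ E₀
  expanded = Expansion.Φ-expansion G Φ wfΦ E₀ E₀⊆ E₀-neutral
  regrouped : signedSum Φ E₀ ∼ möbiusSum Φ E₀
  regrouped = Regrouping.signedSum∼möbiusSum G Φ wfΦ E₀ E₀⊆
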